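{- For the Dedukti encoding $(\Sigma_{EPTS},\mathscr R_{EPTS})$ of a functional PTS specification: (1) $\hookrightarrow_\beta\cup\hookrightarrow_{\mathscr R_{EPTS}}$ is confluent; (2) for every $c[\Delta]:A\in\Sigma_{EPTS}$ one has $\Delta\vdash_{DK}A:s$ for some $s\in\{\mathtt{TYPE},\mathtt{KIND}\}$; (3) if $\Gamma\vdash_{DK}M:A$ and $M\hookrightarrow_\beta M'$ then $\Gamma\vdash_{DK}M':A$; (4) if $\Gamma\vdash_{DK}M:A$ then $\beta$ is strongly normalizing on $M$; (5) for all EPTS terms $M,N$, $[\![M]\!]\{[\![N]\!]/x\}=[\![M\{N/x\}]\!]$.
   Context: Functional PTS specification $(\mathcal S,\mathcal A,\mathcal R)$: $\mathcal A\subseteq\mathcal S^2$ functional, $\mathcal R\subseteq\mathcal S^3$ functional in its first two components. EPTS terms $x\mid s\mid\Pi_{s_1,s_2}(A,x.B)\mid\lambda_{s_1,s_2}(A,x.B,x.M)\mid@_{s_1,s_2}(A,x.B,M,N)$. Dedukti: $\lambda\Pi$-calculus with constants $c[\Delta]:A$ of fixed arity (written $c\,\vec M$), conversion modulo $\beta$ and rewrite rules; $\Gamma\vdash_{DK}M:A$ denotes Dedukti typing in the theory $(\Sigma_{EPTS},\mathscr R_{EPTS})$ given by: $\mathbf U_s:\mathtt{TYPE}$, $\mathbf{El}_s[A:\mathbf U_s]:\mathtt{TYPE}$ ($s\in\mathcal S$); for $(s_1,s_2)\in\mathcal A$: $\mathbf u_{s_1}:\mathbf U_{s_2}$ and rule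 $\mathbf{El}_{s_2}\mathbf u_{s_1}\hookrightarrow\mathbf U_{s_1}$; for $(s_1,s_2,s_3)\in\mathcal R$: $\mathbf{Prod}_{s_1,s_2}[A:\mathbf U_{s_1};B:\mathbf{El}_{s_1}A\to\mathbf U_{s_2}]:\mathbf U_{s_3}$, $\mathbf{abs}_{s_1,s_2}[A:\mathbf U_{s_1};B:\mathbf{El}_{s_1}A\to\mathbf U_{s_2};M:\Pi x:\mathbf{El}_{s_1}A.\mathbf{El}_{s_2}(Bx)]:\mathbf{El}_{s_3}(\mathbf{Prod}_{s_1,s_2}AB)$, $\mathbf{app}_{s_1,s_2}[A:\mathbf U_{s_1};B:\mathbf{El}_{s_1}A\to\mathbf U_{s_2};M:\mathbf{El}_{s_3}(\mathbf{Prod}_{s_1,s_2}AB);N:\mathbf{El}_{s_1}A]:\mathbf{El}_{s_2}(BN)$, and rule $\mathbf{app}_{s_1,s_2}AB(\mathbf{abs}_{s_1,s_2}A'B'M)N\hookrightarrow MN$. Translation: $[\![x]\!]=x$, $[\![s]\!]=\mathbf u_s$, $[\![\Pi_{s_1,s_2}(A,x.B)]\!]=\mathbf{Prod}_{s_1,s_2}[\![A]\!](\lambda x:\mathbf{El}_{s_1}[\![A]\!].[\![B]\!])$, $[\![\lambda_{s_1,s_2}(A,x.B,x.M)]\!]=\mathbf{abs}_{s_1,s_2}[\![A]\!](\lambda x:\mathbf{El}_{s_1}[\![A]\!].[\![B]\!])(\lambda x:\mathbf{El}_{s_1}[\![A]\!].[\![M]\!])$, $[\![@_{s_1,s_2}(A,x.B,M,N)]\!]=\mathbf{app}_{s_1,s_2}[\![A]\!](\lambda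 x:\mathbf{El}_{s_1}[\![A]\!].[\![B]\!])[\![M]\!][\![N]\!]$. -}

module Defs where

open import Data.Nat using (ℕ; zero; suc)
open import Data.List using (List; []; _∷_; reverse)
open import Data.Product using (Σ; ∃; _×_)
open import Function using (flip)
open import Relation.Binary.PropositionalEquality using (_≡_)
open import Relation.Binary.Construct.Closure.Equivalence using (EqClosure)
open import Induction.WellFounded using (Acc)
open import Relation.Binary.Rewriting using (Confluent)

record Spec : Set₁ where
  field
    Sort   : Set
    Ax     : Sort → Sort → Set
    Rl     : Sort → Sort → Sort → Set
    Ax-fun : ∀ {s s₁ s₂} → Ax s s₁ → Ax s s₂ → s₁ ≡ s₂
    Rl-fun : ∀ {s₁ s₂ s s'} → Rl s₁ s₂ s → Rl s₁ s₂ s' → s ≡ s'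

module Encoding (𝒮 : Spec) where
  open Spec 𝒮

  data Const : Set where
    U El u       : Sort → Const
    Prod abs app : Sort → Sort → Const

  -- constants are always fully applied: con c (M₁ ∷ … ∷ Mₙ ∷ [])  is  c M⃗
  data Tm : Set where
    var  : ℕ → Tm
    TYPE : Tm
    KIND : Tm
    Π    : Tm → Tm → Tm            -- Π x : A . B   (B under one binder)
    ƛ    : Tm → Tm → Tm            -- λ x : A . M   (M under one binder)
    _·_  : Tm → Tm → Tm
    con  : Const → List Tm → Tm

  infixl 7 _·_

  Ren : Set
  Ren = ℕ → ℕ

  ext : Ren → Ren
  ext ρ zero    = zero
  ext ρ (suc n) = suc (ρ n)

  mutual
    ren : Ren → Tm → Tm
    ren ρ (var x)    = var (ρ x)
    ren ρ TYPE       = TYPE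
    ren ρ KIND       = KIND
    ren ρ (Π A B)    = Π (ren ρ A) (ren (ext ρ) B)
    ren ρ (ƛ A M)    = ƛ (ren ρ A) (ren (ext ρ) M)
    ren ρ (M · N)    = ren ρ M · ren ρ N
    ren ρ (con c Ms) = con c (renL ρ Ms)

    renL : Ren → List Tm → List Tm
    renL ρ []       = []
    renL ρ (M ∷ Ms) = ren ρ M ∷ renL ρ Ms

  Sub : Set
  Sub = ℕ → Tm

  exts : Sub → Sub
  exts σ zero    = var zero
  exts σ (suc n) = ren suc (σ n)

  mutual
    sub : Sub → Tm → Tm
    sub σ (var x)    = σ x
    sub σ TYPE       = TYPE
    sub σ KIND       = KIND
    sub σ (Π A B)    = Π (sub σ A) (sub (exts σ) B)
    sub σ (ƛ A M)    = ƛ (sub σ A) (sub (exts σ) M)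
    sub σ (M · N)    = sub σ M · sub σ N
    sub σ (con c Ms) = con c (subL σ Ms)

    subL : Sub → List Tm → List Tm
    subL σ []       = []
    subL σ (M ∷ Ms) = sub σ M ∷ subL σ Ms

  single : Tm → Sub
  single N zero    = N
  single N (suc n) = var n

  _[_]₀ : Tm → Tm → Tm
  M [ N ]₀ = sub (single N) M

  fromList : List Tm → Sub
  fromList []       n       = var n
  fromList (M ∷ γ)  zero    = M
  fromList (M ∷ γ)  (suc n) = fromList γ n

  -- instantiation by the arguments γ = M₁ … Mₙ (natural order, Mₙ = var 0)
  inst : List Tm → Sub
  inst γ = fromList (reverse γ)

  -- Contexts: lists whose head is the most recently bound variable

  Ctx : Set
  Ctx = List Tm

  data _∋_∶_ : Ctx → ℕ → Tm → Set where
    here  : ∀ {Γ A}     → (A ∷ Γ) ∋ zero ∶ ren suc A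
    there : ∀ {Γ A B i} → Γ ∋ i ∶ A → (B ∷ Γ) ∋ suc i ∶ ren suc A

  U′ : Sort → Tm
  U′ s = con (U s) []

  El′ : Sort → Tm → Tm
  El′ s A = con (El s) (A ∷ [])

  data _∶[_]_∈Σ : Const → Ctx → Tm → Set where
    σ-U    : ∀ s → U s ∶[ [] ] TYPE ∈Σ
    σ-El   : ∀ s → El s ∶[ U′ s ∷ [] ] TYPE ∈Σ
    σ-u    : ∀ {s₁ s₂} → Ax s₁ s₂ → u s₁ ∶[ [] ] U′ s₂ ∈Σ
    -- Prod [A : U s₁ ; B : El s₁ A → U s₂] : U s₃
    σ-Prod : ∀ {s₁ s₂ s₃} → Rl s₁ s₂ s₃ →
      Prod s₁ s₂ ∶[ Π (El′ s₁ (var 0)) (U′ s₂) ∷ U′ s₁ ∷ [] ] U′ s₃ ∈Σ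
    -- abs [A ; B ; M : Π x : El s₁ A . El s₂ (B x)] : El s₃ (Prod A B)
    σ-abs  : ∀ {s₁ s₂ s₃} → Rl s₁ s₂ s₃ →
      abs s₁ s₂ ∶[ Π (El′ s₁ (var 1)) (El′ s₂ (var 1 · var 0))
                 ∷ Π (El′ s₁ (var 0)) (U′ s₂) ∷ U′ s₁ ∷ [] ]
                 El′ s₃ (con (Prod s₁ s₂) (var 2 ∷ var 1 ∷ [])) ∈Σ
    -- app [A ; B ; M : El s₃ (Prod A B) ; N : El s₁ A] : El s₂ (B N)
    σ-app  : ∀ {s₁ s₂ s₃} → Rl s₁ s₂ s₃ →
      app s₁ s₂ ∶[ El′ s₁ (var 2)
                 ∷ El′ s₃ (con (Prod s₁ s₂) (var 1 ∷ var 0 ∷ []))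
                 ∷ Π (El′ s₁ (var 0)) (U′ s₂) ∷ U′ s₁ ∷ [] ]
                 El′ s₂ (var 2 · var 0) ∈Σ

  data _↦β_ : Tm → Tm → Set where
    beta : ∀ A M N → (ƛ A M · N) ↦β (M [ N ]₀)

  data _↦R_ : Tm → Tm → Set where
    r-El  : ∀ {s₁ s₂} → Ax s₁ s₂ →
      con (El s₂) (con (u s₁) [] ∷ []) ↦R U′ s₁
    r-app : ∀ {s₁ s₂ s₃} → Rl s₁ s₂ s₃ → ∀ A B A′ B′ M N →
      con (app s₁ s₂) (A ∷ B ∷ con (abs s₁ s₂) (A′ ∷ B′ ∷ M ∷ []) ∷ N ∷ [])
        ↦R (M · N)

  data _↦βR_ : Tm → Tm → Set where
    β-step : ∀ {M N} → M ↦β N → M ↦βR N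
    R-step : ∀ {M N} → M ↦R N → M ↦βR N

  mutual
    data Cl (R : Tm → Tm → Set) : Tm → Tm → Set where
      top  : ∀ {M N}      → R M N → Cl R M N
      Π₁   : ∀ {A A′ B}   → Cl R A A′ → Cl R (Π A B) (Π A′ B)
      Π₂   : ∀ {A B B′}   → Cl R B B′ → Cl R (Π A B) (Π A B′)
      ƛ₁   : ∀ {A A′ M}   → Cl R A A′ → Cl R (ƛ A M) (ƛ A′ M)
      ƛ₂   : ∀ {A M M′}   → Cl R M M′ → Cl R (ƛ A M) (ƛ A M′)
      ·₁   : ∀ {M M′ N}   → Cl R M M′ → Cl R (M · N) (M′ · N)
      ·₂   : ∀ {M N N′}   → Cl R N N′ → Cl R (M · N) (M · N′)
      conₐ : ∀ {c Ms Ms′} → ClL R Ms Ms′ → Cl R (con c Ms) (con c Ms′)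

    data ClL (R : Tm → Tm → Set) : List Tm → List Tm → Set where
      hd : ∀ {M M′ Ms} → Cl R M M′ → ClL R (M ∷ Ms) (M′ ∷ Ms)
      tl : ∀ {M Ms Ms′} → ClL R Ms Ms′ → ClL R (M ∷ Ms) (M ∷ Ms′)

  _⟶β_ : Tm → Tm → Set
  _⟶β_ = Cl _↦β_

  _⟶βR_ : Tm → Tm → Set
  _⟶βR_ = Cl _↦βR_

  _≡βR_ : Tm → Tm → Set
  _≡βR_ = EqClosure _⟶βR_

  data IsSort : Tm → Set where
    sTYPE : IsSort TYPE
    sKIND : IsSort KIND

  infix 4 ⊢_ _⊢_∶_ _⊢ₐ_∶_

  mutual
    data ⊢_ : Ctx → Set where
      wf-∅ : ⊢ []
      wf-∷ : ∀ {Γ A} → Γ ⊢ A ∶ TYPE → ⊢ (A ∷ Γ)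

    data _⊢_∶_ : Ctx → Tm → Tm → Set where
      t-sort : ∀ {Γ} → ⊢ Γ → Γ ⊢ TYPE ∶ KIND
      t-var  : ∀ {Γ i A} → ⊢ Γ → Γ ∋ i ∶ A → Γ ⊢ var i ∶ A
      t-con  : ∀ {Γ c Δ A γ} → ⊢ Γ → c ∶[ Δ ] A ∈Σ → Γ ⊢ₐ γ ∶ Δ →
               Γ ⊢ con c γ ∶ sub (inst γ) A
      t-conv : ∀ {Γ M A B s} → Γ ⊢ M ∶ A → IsSort s → Γ ⊢ B ∶ s → A ≡βR B →
               Γ ⊢ M ∶ B
      t-Π    : ∀ {Γ A B s} → IsSort s → Γ ⊢ A ∶ TYPE → (A ∷ Γ) ⊢ B ∶ s →
               Γ ⊢ Π A B ∶ s
      t-ƛ    : ∀ {Γ A B M s} → IsSort s → (A ∷ Γ) ⊢ B ∶ s → (A ∷ Γ) ⊢ M ∶ B →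
               Γ ⊢ ƛ A M ∶ Π A B
      t-app  : ∀ {Γ M N A B} → Γ ⊢ M ∶ Π A B → Γ ⊢ N ∶ A →
               Γ ⊢ M · N ∶ B [ N ]₀

    -- Γ ⊢ γ : Δ  for an argument list γ = M₁ … Mₙ (natural order);
    -- Δ is a context (head = last argument's type)
    data _⊢ₐ_∶_ : Ctx → List Tm → Ctx → Set where
      a-∅ : ∀ {Γ} → Γ ⊢ₐ [] ∶ []
      a-∷ : ∀ {Γ γ Δ M A} → Γ ⊢ₐ γ ∶ Δ → Γ ⊢ M ∶ sub (inst γ) A →
            Γ ⊢ₐ (γ Data.List.∷ʳ M) ∶ (A ∷ Δ)

  SNβ : Tm → Set
  SNβ = Acc (flip _⟶β_)

  data ETm : Set where
    evar  : ℕ → ETm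
    esort : Sort → ETm
    ePi   : Sort → Sort → ETm → ETm → ETm                 -- Π(A, x.B)
    eLam  : Sort → Sort → ETm → ETm → ETm → ETm           -- λ(A, x.B, x.M)
    eApp  : Sort → Sort → ETm → ETm → ETm → ETm → ETm     -- @(A, x.B, M, N)

  eren : Ren → ETm → ETm
  eren ρ (evar x)             = evar (ρ x)
  eren ρ (esort s)            = esort s
  eren ρ (ePi s₁ s₂ A B)      = ePi s₁ s₂ (eren ρ A) (eren (ext ρ) B)
  eren ρ (eLam s₁ s₂ A B M)   = eLam s₁ s₂ (eren ρ A) (eren (ext ρ) B) (eren (ext ρ) M)
  eren ρ (eApp s₁ s₂ A B M N) = eApp s₁ s₂ (eren ρ A) (eren (ext ρ) B) (eren ρ M) (eren ρ N)

  ESub : Set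
  ESub = ℕ → ETm

  eexts : ESub → ESub
  eexts σ zero    = evar zero
  eexts σ (suc n) = eren suc (σ n)

  esub : ESub → ETm → ETm
  esub σ (evar x)             = σ x
  esub σ (esort s)            = esort s
  esub σ (ePi s₁ s₂ A B)      = ePi s₁ s₂ (esub σ A) (esub (eexts σ) B)
  esub σ (eLam s₁ s₂ A B M)   = eLam s₁ s₂ (esub σ A) (esub (eexts σ) B) (esub (eexts σ) M)
  esub σ (eApp s₁ s₂ A B M N) = eApp s₁ s₂ (esub σ A) (esub (eexts σ) B) (esub σ M) (esub σ N)

  esingle : ETm → ESub
  esingle N zero    = N
  esingle N (suc n) = evar n

  _[_]ₑ : ETm → ETm → ETm
  M [ N ]ₑ = esub (esingle N) M

  ⟦_⟧ : ETm → Tm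
  ⟦ evar x ⟧             = var x
  ⟦ esort s ⟧            = con (u s) []
  ⟦ ePi s₁ s₂ A B ⟧      =
    con (Prod s₁ s₂) (⟦ A ⟧ ∷ ƛ (El′ s₁ ⟦ A ⟧) ⟦ B ⟧ ∷ [])
  ⟦ eLam s₁ s₂ A B M ⟧   =
    con (abs s₁ s₂) (⟦ A ⟧ ∷ ƛ (El′ s₁ ⟦ A ⟧) ⟦ B ⟧ ∷ ƛ (El′ s₁ ⟦ A ⟧) ⟦ M ⟧ ∷ [])
  ⟦ eApp s₁ s₂ A B M N ⟧ =
    con (app s₁ s₂) (⟦ A ⟧ ∷ ƛ (El′ s₁ ⟦ A ⟧) ⟦ B ⟧ ∷ ⟦ M ⟧ ∷ ⟦ N ⟧ ∷ [])

  Prop1-Confluence : Set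
  Prop1-Confluence = Confluent _⟶βR_

  Prop2-SignatureWellTyped : Set
  Prop2-SignatureWellTyped =
    ∀ {c Δ A} → c ∶[ Δ ] A ∈Σ → ∃ λ s → IsSort s × (Δ ⊢ A ∶ s)

  Prop3-SubjectReductionβ : Set
  Prop3-SubjectReductionβ =
    ∀ {Γ M M′ A} → Γ ⊢ M ∶ A → M ⟶β M′ → Γ ⊢ M′ ∶ A

  Prop4-StrongNormalisationβ : Set
  Prop4-StrongNormalisationβ = ∀ {Γ M A} → Γ ⊢ M ∶ A → SNβ M

  Prop5-SubstitutionCommutes : Set
  Prop5-SubstitutionCommutes = ∀ M N → ⟦ M ⟧ [ ⟦ N ⟧ ]₀ ≡ ⟦ M [ N ]ₑ ⟧

-- (1) β and the two rules of ℛ_EPTS are left-linear and do not overlap, so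
-- the parallel reduction of Tait and Martin-Löf has the diamond property.
-- (3) Confluence makes Π and El (Prod A B) injective under conversion, which is
-- exactly what is needed to retype the contractum of a β- or app/abs-redex.
-- (4) The skeleton ∣_∣ forgets dependencies and sends every type built from
-- the signature to a base type; it maps Dedukti derivations to simply typed
-- ones, because a redex only ever substitutes an object (a term whose type is
-- not convertible to an arity TYPE, KIND, Π x:A.K) and objects have skeleton o,
-- so ∣_∣ is invariant under conversion of well-typed types. Reducibility then
-- gives strong normalisation of simply typed terms.

module Submission where

open import Defs
open import Level using (Level; _⊔_)
open import Data.Nat using (ℕ; zero; suc)
open import Data.List using (List; []; _∷_)
import Data.List as List
open import Data.Product using (_×_; _,_; ∃; ∃₂; proj₁; proj₂)
open import Data.Sum using (_⊎_; inj₁; inj₂)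
open import Data.Unit using (⊤; tt)
open import Data.Empty using (⊥; ⊥-elim)
open import Function using (_∘_; id; flip)
open import Relation.Nullary using (¬_)
open import Relation.Binary.Core using (Rel; _⇒_)
open import Relation.Binary.PropositionalEquality
  using (_≡_; refl; sym; trans; cong; cong₂; subst; subst₂; _≗_; module ≡-Reasoning)
open import Relation.Binary.Construct.Closure.ReflexiveTransitive
  using (Star; ε; _◅_; _◅◅_; gmap)
import Relation.Binary.Construct.Closure.ReflexiveTransitive as Star
open import Relation.Binary.Construct.Closure.Symmetric using (fwd; bwd)
open import Relation.Binary.Construct.Closure.Equivalence using (EqClosure)
import Relation.Binary.Construct.Closure.Equivalence as EqClosure
open import Relation.Binary.Construct.Closure.Equivalence.Properties
  using (a—↠b⇒a↔b; a—↠b⇒b↔a)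
open import Relation.Binary.Rewriting using (Confluent)
open import Induction.WellFounded using (Acc; acc)

module _ {a ℓ : Level} {A : Set a} where

  Diamond : Rel A ℓ → Set (a ⊔ ℓ)
  Diamond _⇛_ = ∀ {M N₁ N₂} → M ⇛ N₁ → M ⇛ N₂ → ∃ λ P → N₁ ⇛ P × N₂ ⇛ P

  Joinable : Rel A ℓ → Rel A (a ⊔ ℓ)
  Joinable _⟶_ M N = ∃ λ P → Star _⟶_ M P × Star _⟶_ N P

  module _ {_⇛_ : Rel A ℓ} (diamond : Diamond _⇛_) where

    strip : ∀ {M N₁ N₂} → M ⇛ N₁ → Star _⇛_ M N₂ → ∃ λ P → Star _⇛_ N₁ P × N₂ ⇛ P
    strip p ε = _ , ε , p
    strip p (q ◅ qs) with diamond p q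
    ... | _ , p′ , q′ with strip q′ qs
    ...   | P , ps , r = P , p′ ◅ ps , r

    diamond⇒confluent : Confluent _⇛_
    diamond⇒confluent ε qs = _ , qs , ε
    diamond⇒confluent (p ◅ ps) qs with strip p qs
    ... | _ , qs′ , r with diamond⇒confluent ps qs′
    ...   | P , ps″ , qs″ = P , ps″ , r ◅ qs″

  module _ {_⟶_ _⇛_ : Rel A ℓ} where

    confluent-by-parallel : _⟶_ ⇒ _⇛_ → _⇛_ ⇒ Star _⟶_ → Diamond _⇛_ → Confluent _⟶_
    confluent-by-parallel ⟶⇒⇛ ⇛⇒⟶* diamond ps qs
      with diamond⇒confluent diamond (Star.map ⟶⇒⇛ ps) (Star.map ⟶⇒⇛ qs)
    ... | P , ps′ , qs′ = P , expand ps′ , expand qs′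
      where
      expand : Star _⇛_ ⇒ Star _⟶_
      expand rs = Star.concat (Star.map ⇛⇒⟶* rs)

  confluent⇒church-rosser : {_⟶_ : Rel A ℓ} → Confluent _⟶_ → EqClosure _⟶_ ⇒ Joinable _⟶_
  confluent⇒church-rosser conf ε = _ , ε , ε
  confluent⇒church-rosser conf (fwd r ◅ e) with confluent⇒church-rosser conf e
  ... | P , ps , qs = P , r ◅ ps , qs
  confluent⇒church-rosser conf (bwd r ◅ e) with confluent⇒church-rosser conf e
  ... | P , ps , qs with conf (r ◅ ε) ps
  ...   | Q , rs , ps′ = Q , rs , qs ◅◅ ps′


module Theory (𝒮 : Spec) where
  open Spec 𝒮
  open Encoding 𝒮

  -- Renaming and substitution

  ext-cong : ∀ {ρ ρ′} → ρ ≗ ρ′ → ext ρ ≗ ext ρ′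
  ext-cong e zero    = refl
  ext-cong e (suc x) = cong suc (e x)

  mutual
    ren-cong : ∀ {ρ ρ′} → ρ ≗ ρ′ → ren ρ ≗ ren ρ′
    ren-cong e (var x)    = cong var (e x)
    ren-cong e TYPE       = refl
    ren-cong e KIND       = refl
    ren-cong e (Π A B)    = cong₂ Π (ren-cong e A) (ren-cong (ext-cong e) B)
    ren-cong e (ƛ A M)    = cong₂ ƛ (ren-cong e A) (ren-cong (ext-cong e) M)
    ren-cong e (M · N)    = cong₂ _·_ (ren-cong e M) (ren-cong e N)
    ren-cong e (con c Ms) = cong (con c) (renL-cong e Ms)

    renL-cong : ∀ {ρ ρ′} → ρ ≗ ρ′ → renL ρ ≗ renL ρ′
    renL-cong e []       = refl
    renL-cong e (M ∷ Ms) = cong₂ _∷_ (ren-cong e M) (renL-cong e Ms)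

  exts-cong : ∀ {σ σ′} → σ ≗ σ′ → exts σ ≗ exts σ′
  exts-cong e zero    = refl
  exts-cong e (suc x) = cong (ren suc) (e x)

  mutual
    sub-cong : ∀ {σ σ′} → σ ≗ σ′ → sub σ ≗ sub σ′
    sub-cong e (var x)    = e x
    sub-cong e TYPE       = refl
    sub-cong e KIND       = refl
    sub-cong e (Π A B)    = cong₂ Π (sub-cong e A) (sub-cong (exts-cong e) B)
    sub-cong e (ƛ A M)    = cong₂ ƛ (sub-cong e A) (sub-cong (exts-cong e) M)
    sub-cong e (M · N)    = cong₂ _·_ (sub-cong e M) (sub-cong e N)
    sub-cong e (con c Ms) = cong (con c) (subL-cong e Ms)

    subL-cong : ∀ {σ σ′} → σ ≗ σ′ → subL σ ≗ subL σ′
    subL-cong e []       = refl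
    subL-cong e (M ∷ Ms) = cong₂ _∷_ (sub-cong e M) (subL-cong e Ms)

  ext-∘ : ∀ ρ ρ′ → ext ρ ∘ ext ρ′ ≗ ext (ρ ∘ ρ′)
  ext-∘ ρ ρ′ zero    = refl
  ext-∘ ρ ρ′ (suc x) = refl

  mutual
    ren-ren : ∀ ρ ρ′ M → ren ρ (ren ρ′ M) ≡ ren (ρ ∘ ρ′) M
    ren-ren ρ ρ′ (var x)    = refl
    ren-ren ρ ρ′ TYPE       = refl
    ren-ren ρ ρ′ KIND       = refl
    ren-ren ρ ρ′ (Π A B)    = cong₂ Π (ren-ren ρ ρ′ A) (ren-ren-ext ρ ρ′ B)
    ren-ren ρ ρ′ (ƛ A M)    = cong₂ ƛ (ren-ren ρ ρ′ A) (ren-ren-ext ρ ρ′ M)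
    ren-ren ρ ρ′ (M · N)    = cong₂ _·_ (ren-ren ρ ρ′ M) (ren-ren ρ ρ′ N)
    ren-ren ρ ρ′ (con c Ms) = cong (con c) (renL-renL ρ ρ′ Ms)

    ren-ren-ext : ∀ ρ ρ′ M → ren (ext ρ) (ren (ext ρ′) M) ≡ ren (ext (ρ ∘ ρ′)) M
    ren-ren-ext ρ ρ′ M = trans (ren-ren (ext ρ) (ext ρ′) M) (ren-cong (ext-∘ ρ ρ′) M)

    renL-renL : ∀ ρ ρ′ Ms → renL ρ (renL ρ′ Ms) ≡ renL (ρ ∘ ρ′) Ms
    renL-renL ρ ρ′ []       = refl
    renL-renL ρ ρ′ (M ∷ Ms) = cong₂ _∷_ (ren-ren ρ ρ′ M) (renL-renL ρ ρ′ Ms)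

  exts-ext : ∀ σ ρ → exts σ ∘ ext ρ ≗ exts (σ ∘ ρ)
  exts-ext σ ρ zero    = refl
  exts-ext σ ρ (suc x) = refl

  mutual
    sub-ren : ∀ σ ρ M → sub σ (ren ρ M) ≡ sub (σ ∘ ρ) M
    sub-ren σ ρ (var x)    = refl
    sub-ren σ ρ TYPE       = refl
    sub-ren σ ρ KIND       = refl
    sub-ren σ ρ (Π A B)    = cong₂ Π (sub-ren σ ρ A) (sub-ren-ext σ ρ B)
    sub-ren σ ρ (ƛ A M)    = cong₂ ƛ (sub-ren σ ρ A) (sub-ren-ext σ ρ M)
    sub-ren σ ρ (M · N)    = cong₂ _·_ (sub-ren σ ρ M) (sub-ren σ ρ N)
    sub-ren σ ρ (con c Ms) = cong (con c) (subL-renL σ ρ Ms)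

    sub-ren-ext : ∀ σ ρ M → sub (exts σ) (ren (ext ρ) M) ≡ sub (exts (σ ∘ ρ)) M
    sub-ren-ext σ ρ M = trans (sub-ren (exts σ) (ext ρ) M) (sub-cong (exts-ext σ ρ) M)

    subL-renL : ∀ σ ρ Ms → subL σ (renL ρ Ms) ≡ subL (σ ∘ ρ) Ms
    subL-renL σ ρ []       = refl
    subL-renL σ ρ (M ∷ Ms) = cong₂ _∷_ (sub-ren σ ρ M) (subL-renL σ ρ Ms)

  ren-ext-exts : ∀ ρ σ → ren (ext ρ) ∘ exts σ ≗ exts (ren ρ ∘ σ)
  ren-ext-exts ρ σ zero    = refl
  ren-ext-exts ρ σ (suc x) = trans (ren-ren (ext ρ) suc (σ x)) (sym (ren-ren suc ρ (σ x)))

  mutual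
    ren-sub : ∀ ρ σ M → ren ρ (sub σ M) ≡ sub (ren ρ ∘ σ) M
    ren-sub ρ σ (var x)    = refl
    ren-sub ρ σ TYPE       = refl
    ren-sub ρ σ KIND       = refl
    ren-sub ρ σ (Π A B)    = cong₂ Π (ren-sub ρ σ A) (ren-sub-exts ρ σ B)
    ren-sub ρ σ (ƛ A M)    = cong₂ ƛ (ren-sub ρ σ A) (ren-sub-exts ρ σ M)
    ren-sub ρ σ (M · N)    = cong₂ _·_ (ren-sub ρ σ M) (ren-sub ρ σ N)
    ren-sub ρ σ (con c Ms) = cong (con c) (renL-subL ρ σ Ms)

    ren-sub-exts : ∀ ρ σ M → ren (ext ρ) (sub (exts σ) M) ≡ sub (exts (ren ρ ∘ σ)) M
    ren-sub-exts ρ σ M = trans (ren-sub (ext ρ) (exts σ) M) (sub-cong (ren-ext-exts ρ σ) M)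

    renL-subL : ∀ ρ σ Ms → renL ρ (subL σ Ms) ≡ subL (ren ρ ∘ σ) Ms
    renL-subL ρ σ []       = refl
    renL-subL ρ σ (M ∷ Ms) = cong₂ _∷_ (ren-sub ρ σ M) (renL-subL ρ σ Ms)

  sub-exts-exts : ∀ σ τ → sub (exts σ) ∘ exts τ ≗ exts (sub σ ∘ τ)
  sub-exts-exts σ τ zero    = refl
  sub-exts-exts σ τ (suc x) = trans (sub-ren (exts σ) suc (τ x)) (sym (ren-sub suc σ (τ x)))

  mutual
    sub-sub : ∀ σ τ M → sub σ (sub τ M) ≡ sub (sub σ ∘ τ) M
    sub-sub σ τ (var x)    = refl
    sub-sub σ τ TYPE       = refl
    sub-sub σ τ KIND       = refl
    sub-sub σ τ (Π A B)    = cong₂ Π (sub-sub σ τ A) (sub-sub-exts σ τ B)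
    sub-sub σ τ (ƛ A M)    = cong₂ ƛ (sub-sub σ τ A) (sub-sub-exts σ τ M)
    sub-sub σ τ (M · N)    = cong₂ _·_ (sub-sub σ τ M) (sub-sub σ τ N)
    sub-sub σ τ (con c Ms) = cong (con c) (subL-subL σ τ Ms)

    sub-sub-exts : ∀ σ τ M → sub (exts σ) (sub (exts τ) M) ≡ sub (exts (sub σ ∘ τ)) M
    sub-sub-exts σ τ M = trans (sub-sub (exts σ) (exts τ) M) (sub-cong (sub-exts-exts σ τ) M)

    subL-subL : ∀ σ τ Ms → subL σ (subL τ Ms) ≡ subL (sub σ ∘ τ) Ms
    subL-subL σ τ []       = refl
    subL-subL σ τ (M ∷ Ms) = cong₂ _∷_ (sub-sub σ τ M) (subL-subL σ τ Ms)

  exts-var : exts var ≗ var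
  exts-var zero    = refl
  exts-var (suc x) = refl

  mutual
    sub-var : ∀ {σ} → σ ≗ var → ∀ M → sub σ M ≡ M
    sub-var e (var x)    = e x
    sub-var e TYPE       = refl
    sub-var e KIND       = refl
    sub-var e (Π A B)    = cong₂ Π (sub-var e A) (sub-var (exts-var′ e) B)
    sub-var e (ƛ A M)    = cong₂ ƛ (sub-var e A) (sub-var (exts-var′ e) M)
    sub-var e (M · N)    = cong₂ _·_ (sub-var e M) (sub-var e N)
    sub-var e (con c Ms) = cong (con c) (subL-var e Ms)

    exts-var′ : ∀ {σ} → σ ≗ var → exts σ ≗ var
    exts-var′ e x = trans (exts-cong e x) (exts-var x)

    subL-var : ∀ {σ} → σ ≗ var → ∀ Ms → subL σ Ms ≡ Ms
    subL-var e []       = refl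
    subL-var e (M ∷ Ms) = cong₂ _∷_ (sub-var e M) (subL-var e Ms)

  exts-ren : ∀ ρ → exts (var ∘ ρ) ≗ var ∘ ext ρ
  exts-ren ρ zero    = refl
  exts-ren ρ (suc x) = refl

  mutual
    ren≡sub : ∀ ρ M → ren ρ M ≡ sub (var ∘ ρ) M
    ren≡sub ρ (var x)    = refl
    ren≡sub ρ TYPE       = refl
    ren≡sub ρ KIND       = refl
    ren≡sub ρ (Π A B)    = cong₂ Π (ren≡sub ρ A) (ren≡sub-ext ρ B)
    ren≡sub ρ (ƛ A M)    = cong₂ ƛ (ren≡sub ρ A) (ren≡sub-ext ρ M)
    ren≡sub ρ (M · N)    = cong₂ _·_ (ren≡sub ρ M) (ren≡sub ρ N)
    ren≡sub ρ (con c Ms) = cong (con c) (renL≡subL ρ Ms)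

    ren≡sub-ext : ∀ ρ M → ren (ext ρ) M ≡ sub (exts (var ∘ ρ)) M
    ren≡sub-ext ρ M = trans (ren≡sub (ext ρ) M) (sym (sub-cong (exts-ren ρ) M))

    renL≡subL : ∀ ρ Ms → renL ρ Ms ≡ subL (var ∘ ρ) Ms
    renL≡subL ρ []       = refl
    renL≡subL ρ (M ∷ Ms) = cong₂ _∷_ (ren≡sub ρ M) (renL≡subL ρ Ms)

  ren-id : ∀ M → ren id M ≡ M
  ren-id M = trans (ren≡sub id M) (sub-var (λ _ → refl) M)

  _•_ : Tm → Sub → Sub
  (N • σ) zero    = N
  (N • σ) (suc x) = σ x

  sub-exts-[]₀ : ∀ σ N M → sub (exts σ) M [ N ]₀ ≡ sub (N • σ) M
  sub-exts-[]₀ σ N M = trans (sub-sub (single N) (exts σ) M) (sub-cong single∘exts M)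
    where
    single∘exts : sub (single N) ∘ exts σ ≗ N • σ
    single∘exts zero    = refl
    single∘exts (suc x) = trans (sub-ren (single N) suc (σ x)) (sub-var (λ _ → refl) (σ x))

  sub-[]₀ : ∀ σ N M → sub σ (M [ N ]₀) ≡ sub (exts σ) M [ sub σ N ]₀
  sub-[]₀ σ N M = trans (sub-sub σ (single N) M)
    (trans (sub-cong sub∘single M) (sym (sub-exts-[]₀ σ (sub σ N) M)))
    where
    sub∘single : sub σ ∘ single N ≗ sub σ N • σ
    sub∘single zero    = refl
    sub∘single (suc x) = refl

  ren-[]₀ : ∀ ρ N M → ren ρ (M [ N ]₀) ≡ ren (ext ρ) M [ ren ρ N ]₀
  ren-[]₀ ρ N M = begin
    ren ρ (M [ N ]₀)                              ≡⟨ ren≡sub ρ (M [ N ]₀) ⟩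
    sub (var ∘ ρ) (M [ N ]₀)                      ≡⟨ sub-[]₀ (var ∘ ρ) N M ⟩
    sub (exts (var ∘ ρ)) M [ sub (var ∘ ρ) N ]₀
      ≡⟨ cong₂ _[_]₀ (sym (ren≡sub-ext ρ M)) (sym (ren≡sub ρ N)) ⟩
    ren (ext ρ) M [ ren ρ N ]₀                    ∎
    where open ≡-Reasoning

  ren-suc-[]₀ : ∀ N M → ren suc M [ N ]₀ ≡ M
  ren-suc-[]₀ N M = trans (sub-ren (single N) suc M) (sub-var (λ _ → refl) M)

  -- Compatible closures

  module _ {R R′ : Tm → Tm → Set} (R⇒R′ : R ⇒ R′) where
    mutual
      Cl-map : Cl R ⇒ Cl R′
      Cl-map (top r)  = top (R⇒R′ r)
      Cl-map (Π₁ s)   = Π₁ (Cl-map s)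
      Cl-map (Π₂ s)   = Π₂ (Cl-map s)
      Cl-map (ƛ₁ s)   = ƛ₁ (Cl-map s)
      Cl-map (ƛ₂ s)   = ƛ₂ (Cl-map s)
      Cl-map (·₁ s)   = ·₁ (Cl-map s)
      Cl-map (·₂ s)   = ·₂ (Cl-map s)
      Cl-map (conₐ s) = conₐ (ClL-map s)

      ClL-map : ClL R ⇒ ClL R′
      ClL-map (hd s) = hd (Cl-map s)
      ClL-map (tl s) = tl (ClL-map s)

  SubstStable : (Tm → Tm → Set) → Set
  SubstStable R = ∀ σ {M N} → R M N → R (sub σ M) (sub σ N)

  ↦β-stable : SubstStable _↦β_
  ↦β-stable σ (beta A M N) rewrite sub-[]₀ σ N M = beta _ _ _

  ↦βR-stable : SubstStable _↦βR_
  ↦βR-stable σ (β-step r)                     = β-step (↦β-stable σ r)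
  ↦βR-stable σ (R-step (r-El a))              = R-step (r-El a)
  ↦βR-stable σ (R-step (r-app r A B A′ B′ M N)) = R-step (r-app r _ _ _ _ _ _)

  module _ {R : Tm → Tm → Set} where

    Π-↠ : ∀ {A A′ B B′} → Star (Cl R) A A′ → Star (Cl R) B B′ → Star (Cl R) (Π A B) (Π A′ B′)
    Π-↠ a b = gmap _ Π₁ a ◅◅ gmap _ Π₂ b

    ƛ-↠ : ∀ {A A′ M M′} → Star (Cl R) A A′ → Star (Cl R) M M′ → Star (Cl R) (ƛ A M) (ƛ A′ M′)
    ƛ-↠ a m = gmap _ ƛ₁ a ◅◅ gmap _ ƛ₂ m

    ·-↠ : ∀ {M M′ N N′} → Star (Cl R) M M′ → Star (Cl R) N N′ → Star (Cl R) (M · N) (M′ · N′)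
    ·-↠ m n = gmap _ ·₁ m ◅◅ gmap _ ·₂ n

    ∷-↠ : ∀ {M M′ Ms Ms′} → Star (Cl R) M M′ → Star (ClL R) Ms Ms′ →
          Star (ClL R) (M ∷ Ms) (M′ ∷ Ms′)
    ∷-↠ m ms = gmap _ hd m ◅◅ gmap _ tl ms

    con-↠ : ∀ {c Ms Ms′} → Star (ClL R) Ms Ms′ → Star (Cl R) (con c Ms) (con c Ms′)
    con-↠ = gmap _ conₐ

  module _ {R : Tm → Tm → Set} (stable : SubstStable R) where
    mutual
      Cl-sub : SubstStable (Cl R)
      Cl-sub σ (top r)  = top (stable σ r)
      Cl-sub σ (Π₁ s)   = Π₁ (Cl-sub σ s)
      Cl-sub σ (Π₂ s)   = Π₂ (Cl-sub (exts σ) s)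
      Cl-sub σ (ƛ₁ s)   = ƛ₁ (Cl-sub σ s)
      Cl-sub σ (ƛ₂ s)   = ƛ₂ (Cl-sub (exts σ) s)
      Cl-sub σ (·₁ s)   = ·₁ (Cl-sub σ s)
      Cl-sub σ (·₂ s)   = ·₂ (Cl-sub σ s)
      Cl-sub σ (conₐ s) = conₐ (ClL-sub σ s)

      ClL-sub : ∀ σ {Ms Ns} → ClL R Ms Ns → ClL R (subL σ Ms) (subL σ Ns)
      ClL-sub σ (hd s) = hd (Cl-sub σ s)
      ClL-sub σ (tl s) = tl (ClL-sub σ s)

    Cl-ren : ∀ ρ {M N} → Cl R M N → Cl R (ren ρ M) (ren ρ N)
    Cl-ren ρ {M} {N} s rewrite ren≡sub ρ M | ren≡sub ρ N = Cl-sub (var ∘ ρ) s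

    mutual
      sub-↠ : ∀ {σ τ} → (∀ x → Star (Cl R) (σ x) (τ x)) → ∀ M → Star (Cl R) (sub σ M) (sub τ M)
      sub-↠ rs (var x)    = rs x
      sub-↠ rs TYPE       = ε
      sub-↠ rs KIND       = ε
      sub-↠ rs (Π A B)    = Π-↠ (sub-↠ rs A) (sub-↠ (exts-↠ rs) B)
      sub-↠ rs (ƛ A M)    = ƛ-↠ (sub-↠ rs A) (sub-↠ (exts-↠ rs) M)
      sub-↠ rs (M · N)    = ·-↠ (sub-↠ rs M) (sub-↠ rs N)
      sub-↠ rs (con c Ms) = con-↠ (subL-↠ rs Ms)

      subL-↠ : ∀ {σ τ} → (∀ x → Star (Cl R) (σ x) (τ x)) → ∀ Ms →
               Star (ClL R) (subL σ Ms) (subL τ Ms)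
      subL-↠ rs []       = ε
      subL-↠ rs (M ∷ Ms) = ∷-↠ (sub-↠ rs M) (subL-↠ rs Ms)

      exts-↠ : ∀ {σ τ} → (∀ x → Star (Cl R) (σ x) (τ x)) → ∀ x → Star (Cl R) (exts σ x) (exts τ x)
      exts-↠ rs zero    = ε
      exts-↠ rs (suc x) = gmap (ren suc) (Cl-ren suc) (rs x)

    []₀-↠ : ∀ M {N N′} → Cl R N N′ → Star (Cl R) (M [ N ]₀) (M [ N′ ]₀)
    []₀-↠ M {N} {N′} s = sub-↠ single-↠ M
      where
      single-↠ : ∀ x → Star (Cl R) (single N x) (single N′ x)
      single-↠ zero    = s ◅ ε
      single-↠ (suc x) = ε

  ⟦⟧-ren : ∀ ρ M → ⟦ eren ρ M ⟧ ≡ ren ρ ⟦ M ⟧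
  ⟦⟧-ren ρ (evar x)  = refl
  ⟦⟧-ren ρ (esort s) = refl
  ⟦⟧-ren ρ (ePi s₁ s₂ A B)
    rewrite ⟦⟧-ren ρ A | ⟦⟧-ren (ext ρ) B = refl
  ⟦⟧-ren ρ (eLam s₁ s₂ A B M)
    rewrite ⟦⟧-ren ρ A | ⟦⟧-ren (ext ρ) B | ⟦⟧-ren (ext ρ) M = refl
  ⟦⟧-ren ρ (eApp s₁ s₂ A B M N)
    rewrite ⟦⟧-ren ρ A | ⟦⟧-ren (ext ρ) B | ⟦⟧-ren ρ M | ⟦⟧-ren ρ N = refl

  ⟦⟧-exts : ∀ σ → exts (⟦_⟧ ∘ σ) ≗ ⟦_⟧ ∘ eexts σ
  ⟦⟧-exts σ zero    = refl
  ⟦⟧-exts σ (suc x) = sym (⟦⟧-ren suc (σ x))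

  ⟦⟧-sub : ∀ σ M → ⟦ esub σ M ⟧ ≡ sub (⟦_⟧ ∘ σ) ⟦ M ⟧
  ⟦⟧-sub σ (evar x)  = refl
  ⟦⟧-sub σ (esort s) = refl
  ⟦⟧-sub σ (ePi s₁ s₂ A B)
    rewrite ⟦⟧-sub σ A | ⟦⟧-sub (eexts σ) B | sub-cong (⟦⟧-exts σ) ⟦ B ⟧ = refl
  ⟦⟧-sub σ (eLam s₁ s₂ A B M)
    rewrite ⟦⟧-sub σ A | ⟦⟧-sub (eexts σ) B | sub-cong (⟦⟧-exts σ) ⟦ B ⟧
          | ⟦⟧-sub (eexts σ) M | sub-cong (⟦⟧-exts σ) ⟦ M ⟧ = refl
  ⟦⟧-sub σ (eApp s₁ s₂ A B M N)
    rewrite ⟦⟧-sub σ A | ⟦⟧-sub (eexts σ) B | sub-cong (⟦⟧-exts σ) ⟦ B ⟧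
          | ⟦⟧-sub σ M | ⟦⟧-sub σ N = refl

  ⟦⟧-[]₀ : Prop5-SubstitutionCommutes
  ⟦⟧-[]₀ M N = trans (sub-cong single≗⟦esingle⟧ ⟦ M ⟧) (sym (⟦⟧-sub (esingle N) M))
    where
    single≗⟦esingle⟧ : single ⟦ N ⟧ ≗ ⟦_⟧ ∘ esingle N
    single≗⟦esingle⟧ zero    = refl
    single≗⟦esingle⟧ (suc x) = refl

  t-U : ∀ {Γ} s → ⊢ Γ → Γ ⊢ U′ s ∶ TYPE
  t-U s w = t-con w (σ-U s) a-∅

  t-El : ∀ {Γ A} s → ⊢ Γ → Γ ⊢ A ∶ U′ s → Γ ⊢ El′ s A ∶ TYPE
  t-El s w A = t-con w (σ-El s) (a-∷ a-∅ A)

  Prod′ : Sort → Sort → Tm → Tm → Tm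
  Prod′ s₁ s₂ A B = con (Prod s₁ s₂) (A ∷ B ∷ [])

  t-Prod : ∀ {Γ A B s₁ s₂ s₃} → ⊢ Γ → Rl s₁ s₂ s₃ → Γ ⊢ A ∶ U′ s₁ →
          Γ ⊢ B ∶ Π (El′ s₁ A) (U′ s₂) → Γ ⊢ Prod′ s₁ s₂ A B ∶ U′ s₃
  t-Prod w r A B = t-con w (σ-Prod r) (a-∷ (a-∷ a-∅ A) B)

  ⊢[A] : ∀ s₁ → ⊢ (U′ s₁ ∷ [])
  ⊢[A] s₁ = wf-∷ (t-U s₁ wf-∅)

  ⊢[A,B] : ∀ s₁ s₂ → ⊢ (Π (El′ s₁ (var 0)) (U′ s₂) ∷ U′ s₁ ∷ [])
  ⊢[A,B] s₁ s₂ = wf-∷ (t-Π sTYPE El-A (t-U s₂ (wf-∷ El-A)))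
    where El-A = t-El s₁ (⊢[A] s₁) (t-var (⊢[A] s₁) here)

  ⊢[A,B,M] : ∀ s₁ s₂ → ⊢ (Π (El′ s₁ (var 1)) (El′ s₂ (var 1 · var 0))
                          ∷ Π (El′ s₁ (var 0)) (U′ s₂) ∷ U′ s₁ ∷ [])
  ⊢[A,B,M] s₁ s₂ = wf-∷ (t-Π sTYPE El-A (t-El s₂ w (t-app (t-var w (there here)) (t-var w here))))
    where
    El-A = t-El s₁ (⊢[A,B] s₁ s₂) (t-var (⊢[A,B] s₁ s₂) (there here))
    w    = wf-∷ El-A

  ⊢[A,B,M,N] : ∀ {s₁ s₂ s₃} → Rl s₁ s₂ s₃ →
    ⊢ (El′ s₁ (var 2) ∷ El′ s₃ (con (Prod s₁ s₂) (var 1 ∷ var 0 ∷ []))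
       ∷ Π (El′ s₁ (var 0)) (U′ s₂) ∷ U′ s₁ ∷ [])
  ⊢[A,B,M,N] {s₁} {s₂} {s₃} r = wf-∷ (t-El s₁ w′ (t-var w′ (there (there here))))
    where
    w  = ⊢[A,B] s₁ s₂
    w′ = wf-∷ (t-El s₃ w (t-Prod w r (t-var w (there here)) (t-var w here)))

  signature-well-typed : Prop2-SignatureWellTyped
  signature-well-typed (σ-U s)    = KIND , sKIND , t-sort wf-∅
  signature-well-typed (σ-El s)   = KIND , sKIND , t-sort (⊢[A] s)
  signature-well-typed (σ-u {s₂ = s₂} a) = TYPE , sTYPE , t-U s₂ wf-∅
  signature-well-typed (σ-Prod {s₁} {s₂} {s₃} r) = TYPE , sTYPE , t-U s₃ (⊢[A,B] s₁ s₂)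
  signature-well-typed (σ-abs {s₁} {s₂} {s₃} r) = TYPE , sTYPE ,
    t-El s₃ w (t-Prod w r (t-var w (there (there here))) (t-var w (there here)))
    where w = ⊢[A,B,M] s₁ s₂
  signature-well-typed (σ-app {s₁} {s₂} {s₃} r) = TYPE , sTYPE ,
    t-El s₂ w (t-app (t-var w (there (there here))) (t-var w here))
    where w = ⊢[A,B,M,N] r

  -- Parallel reduction and confluence

  _⟶βR*_ : Tm → Tm → Set
  _⟶βR*_ = Star _⟶βR_

  infix 4 _⇛_ _⇛L_

  mutual
    data _⇛_ : Tm → Tm → Set where
      ⇛var  : ∀ {x} → var x ⇛ var x
      ⇛TYPE : TYPE ⇛ TYPE
      ⇛KIND : KIND ⇛ KIND
      ⇛Π    : ∀ {A A′ B B′} → A ⇛ A′ → B ⇛ B′ → Π A B ⇛ Π A′ B′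
      ⇛ƛ    : ∀ {A A′ M M′} → A ⇛ A′ → M ⇛ M′ → ƛ A M ⇛ ƛ A′ M′
      ⇛·    : ∀ {M M′ N N′} → M ⇛ M′ → N ⇛ N′ → M · N ⇛ M′ · N′
      ⇛con  : ∀ {c Ms Ms′} → Ms ⇛L Ms′ → con c Ms ⇛ con c Ms′
      ⇛β    : ∀ {A M M′ N N′} → M ⇛ M′ → N ⇛ N′ → ƛ A M · N ⇛ M′ [ N′ ]₀
      ⇛El   : ∀ {s₁ s₂} → Ax s₁ s₂ → El′ s₂ (con (u s₁) []) ⇛ U′ s₁
      ⇛app  : ∀ {s₁ s₂ s₃} → Rl s₁ s₂ s₃ → ∀ {A B A′ B′ M M′ N N′} → M ⇛ M′ → N ⇛ N′ →
              con (app s₁ s₂) (A ∷ B ∷ con (abs s₁ s₂) (A′ ∷ B′ ∷ M ∷ []) ∷ N ∷ []) ⇛ M′ · N′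

    data _⇛L_ : List Tm → List Tm → Set where
      []  : [] ⇛L []
      _∷_ : ∀ {M M′ Ms Ms′} → M ⇛ M′ → Ms ⇛L Ms′ → (M ∷ Ms) ⇛L (M′ ∷ Ms′)

  mutual
    ⇛-refl : ∀ M → M ⇛ M
    ⇛-refl (var x)    = ⇛var
    ⇛-refl TYPE       = ⇛TYPE
    ⇛-refl KIND       = ⇛KIND
    ⇛-refl (Π A B)    = ⇛Π (⇛-refl A) (⇛-refl B)
    ⇛-refl (ƛ A M)    = ⇛ƛ (⇛-refl A) (⇛-refl M)
    ⇛-refl (M · N)    = ⇛· (⇛-refl M) (⇛-refl N)
    ⇛-refl (con c Ms) = ⇛con (⇛L-refl Ms)

    ⇛L-refl : ∀ Ms → Ms ⇛L Ms
    ⇛L-refl []       = []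
    ⇛L-refl (M ∷ Ms) = ⇛-refl M ∷ ⇛L-refl Ms

  mutual
    ⇛-ren : ∀ ρ {M M′} → M ⇛ M′ → ren ρ M ⇛ ren ρ M′
    ⇛-ren ρ ⇛var       = ⇛var
    ⇛-ren ρ ⇛TYPE      = ⇛TYPE
    ⇛-ren ρ ⇛KIND      = ⇛KIND
    ⇛-ren ρ (⇛Π a b)   = ⇛Π (⇛-ren ρ a) (⇛-ren (ext ρ) b)
    ⇛-ren ρ (⇛ƛ a m)   = ⇛ƛ (⇛-ren ρ a) (⇛-ren (ext ρ) m)
    ⇛-ren ρ (⇛· m n)   = ⇛· (⇛-ren ρ m) (⇛-ren ρ n)
    ⇛-ren ρ (⇛con ms)  = ⇛con (⇛L-ren ρ ms)
    ⇛-ren ρ (⇛β {M′ = M′} {N′ = N′} m n)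
      rewrite ren-[]₀ ρ N′ M′ = ⇛β (⇛-ren (ext ρ) m) (⇛-ren ρ n)
    ⇛-ren ρ (⇛El a)       = ⇛El a
    ⇛-ren ρ (⇛app r m n)  = ⇛app r (⇛-ren ρ m) (⇛-ren ρ n)

    ⇛L-ren : ∀ ρ {Ms Ms′} → Ms ⇛L Ms′ → renL ρ Ms ⇛L renL ρ Ms′
    ⇛L-ren ρ []       = []
    ⇛L-ren ρ (m ∷ ms) = ⇛-ren ρ m ∷ ⇛L-ren ρ ms

  _⇛ˢ_ : Sub → Sub → Set
  σ ⇛ˢ τ = ∀ x → σ x ⇛ τ x

  ⇛ˢ-exts : ∀ {σ τ} → σ ⇛ˢ τ → exts σ ⇛ˢ exts τ
  ⇛ˢ-exts ps zero    = ⇛var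
  ⇛ˢ-exts ps (suc x) = ⇛-ren suc (ps x)

  mutual
    ⇛-sub : ∀ {σ τ M M′} → σ ⇛ˢ τ → M ⇛ M′ → sub σ M ⇛ sub τ M′
    ⇛-sub ps (⇛var {x}) = ps x
    ⇛-sub ps ⇛TYPE      = ⇛TYPE
    ⇛-sub ps ⇛KIND      = ⇛KIND
    ⇛-sub ps (⇛Π a b)   = ⇛Π (⇛-sub ps a) (⇛-sub (⇛ˢ-exts ps) b)
    ⇛-sub ps (⇛ƛ a m)   = ⇛ƛ (⇛-sub ps a) (⇛-sub (⇛ˢ-exts ps) m)
    ⇛-sub ps (⇛· m n)   = ⇛· (⇛-sub ps m) (⇛-sub ps n)
    ⇛-sub ps (⇛con ms)  = ⇛con (⇛L-sub ps ms)
    ⇛-sub {τ = τ} ps (⇛β {M′ = M′} {N′ = N′} m n)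
      rewrite sub-[]₀ τ N′ M′ = ⇛β (⇛-sub (⇛ˢ-exts ps) m) (⇛-sub ps n)
    ⇛-sub ps (⇛El a)      = ⇛El a
    ⇛-sub ps (⇛app r m n) = ⇛app r (⇛-sub ps m) (⇛-sub ps n)

    ⇛L-sub : ∀ {σ τ Ms Ms′} → σ ⇛ˢ τ → Ms ⇛L Ms′ → subL σ Ms ⇛L subL τ Ms′
    ⇛L-sub ps []       = []
    ⇛L-sub ps (m ∷ ms) = ⇛-sub ps m ∷ ⇛L-sub ps ms

  ⇛-[]₀ : ∀ {M M′ N N′} → M ⇛ M′ → N ⇛ N′ → M [ N ]₀ ⇛ M′ [ N′ ]₀
  ⇛-[]₀ {N = N} {N′} m n = ⇛-sub single⇛single m
    where
    single⇛single : single N ⇛ˢ single N′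
    single⇛single zero    = n
    single⇛single (suc x) = ⇛var

  mutual
    ⇛-diamond : Diamond _⇛_
    ⇛-diamond ⇛var  ⇛var  = _ , ⇛var , ⇛var
    ⇛-diamond ⇛TYPE ⇛TYPE = _ , ⇛TYPE , ⇛TYPE
    ⇛-diamond ⇛KIND ⇛KIND = _ , ⇛KIND , ⇛KIND
    ⇛-diamond (⇛Π a b) (⇛Π a′ b′) with ⇛-diamond a a′ | ⇛-diamond b b′
    ... | _ , a₁ , a₂ | _ , b₁ , b₂ = _ , ⇛Π a₁ b₁ , ⇛Π a₂ b₂
    ⇛-diamond (⇛ƛ a m) (⇛ƛ a′ m′) with ⇛-diamond a a′ | ⇛-diamond m m′
    ... | _ , a₁ , a₂ | _ , m₁ , m₂ = _ , ⇛ƛ a₁ m₁ , ⇛ƛ a₂ m₂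
    ⇛-diamond (⇛· m n) (⇛· m′ n′) with ⇛-diamond m m′ | ⇛-diamond n n′
    ... | _ , m₁ , m₂ | _ , n₁ , n₂ = _ , ⇛· m₁ n₁ , ⇛· m₂ n₂
    ⇛-diamond (⇛· (⇛ƛ _ m) n) (⇛β m′ n′) with ⇛-diamond m m′ | ⇛-diamond n n′
    ... | _ , m₁ , m₂ | _ , n₁ , n₂ = _ , ⇛β m₁ n₁ , ⇛-[]₀ m₂ n₂
    ⇛-diamond (⇛β m n) (⇛· (⇛ƛ _ m′) n′) with ⇛-diamond m m′ | ⇛-diamond n n′
    ... | _ , m₁ , m₂ | _ , n₁ , n₂ = _ , ⇛-[]₀ m₁ n₁ , ⇛β m₂ n₂
    ⇛-diamond (⇛β m n) (⇛β m′ n′) with ⇛-diamond m m′ | ⇛-diamond n n′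
    ... | _ , m₁ , m₂ | _ , n₁ , n₂ = _ , ⇛-[]₀ m₁ n₁ , ⇛-[]₀ m₂ n₂
    ⇛-diamond (⇛con ms) (⇛con ms′) with ⇛L-diamond ms ms′
    ... | _ , ms₁ , ms₂ = _ , ⇛con ms₁ , ⇛con ms₂
    ⇛-diamond (⇛con (⇛con [] ∷ [])) (⇛El a) = _ , ⇛El a , ⇛-refl _
    ⇛-diamond (⇛El a) (⇛con (⇛con [] ∷ [])) = _ , ⇛-refl _ , ⇛El a
    ⇛-diamond (⇛El a) (⇛El a′)              = _ , ⇛-refl _ , ⇛-refl _
    ⇛-diamond (⇛con (_ ∷ _ ∷ ⇛con (_ ∷ _ ∷ m ∷ []) ∷ n ∷ [])) (⇛app r m′ n′)
      with ⇛-diamond m m′ | ⇛-diamond n n′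
    ... | _ , m₁ , m₂ | _ , n₁ , n₂ = _ , ⇛app r m₁ n₁ , ⇛· m₂ n₂
    ⇛-diamond (⇛app r m n) (⇛con (_ ∷ _ ∷ ⇛con (_ ∷ _ ∷ m′ ∷ []) ∷ n′ ∷ []))
      with ⇛-diamond m m′ | ⇛-diamond n n′
    ... | _ , m₁ , m₂ | _ , n₁ , n₂ = _ , ⇛· m₁ n₁ , ⇛app r m₂ n₂
    ⇛-diamond (⇛app r m n) (⇛app r′ m′ n′) with ⇛-diamond m m′ | ⇛-diamond n n′
    ... | _ , m₁ , m₂ | _ , n₁ , n₂ = _ , ⇛· m₁ n₁ , ⇛· m₂ n₂

    ⇛L-diamond : Diamond _⇛L_
    ⇛L-diamond [] [] = _ , [] , []
    ⇛L-diamond (m ∷ ms) (m′ ∷ ms′) with ⇛-diamond m m′ | ⇛L-diamond ms ms′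
    ... | _ , m₁ , m₂ | _ , ms₁ , ms₂ = _ , m₁ ∷ ms₁ , m₂ ∷ ms₂

  mutual
    ⟶βR⇒⇛ : _⟶βR_ ⇒ _⇛_
    ⟶βR⇒⇛ (top (β-step (beta A M N)))            = ⇛β (⇛-refl M) (⇛-refl N)
    ⟶βR⇒⇛ (top (R-step (r-El a)))                = ⇛El a
    ⟶βR⇒⇛ (top (R-step (r-app r A B A′ B′ M N))) = ⇛app r (⇛-refl M) (⇛-refl N)
    ⟶βR⇒⇛ (Π₁ {B = B} s) = ⇛Π (⟶βR⇒⇛ s) (⇛-refl B)
    ⟶βR⇒⇛ (Π₂ {A = A} s) = ⇛Π (⇛-refl A) (⟶βR⇒⇛ s)
    ⟶βR⇒⇛ (ƛ₁ {M = M} s) = ⇛ƛ (⟶βR⇒⇛ s) (⇛-refl M)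
    ⟶βR⇒⇛ (ƛ₂ {A = A} s) = ⇛ƛ (⇛-refl A) (⟶βR⇒⇛ s)
    ⟶βR⇒⇛ (·₁ {N = N} s) = ⇛· (⟶βR⇒⇛ s) (⇛-refl N)
    ⟶βR⇒⇛ (·₂ {M = M} s) = ⇛· (⇛-refl M) (⟶βR⇒⇛ s)
    ⟶βR⇒⇛ (conₐ s)       = ⇛con (ClL⇒⇛L s)

    ClL⇒⇛L : ClL _↦βR_ ⇒ _⇛L_
    ClL⇒⇛L (hd {Ms = Ms} s) = ⟶βR⇒⇛ s ∷ ⇛L-refl Ms
    ClL⇒⇛L (tl {M = M} s)   = ⇛-refl M ∷ ClL⇒⇛L s

  mutual
    ⇛⇒⟶βR* : _⇛_ ⇒ _⟶βR*_
    ⇛⇒⟶βR* ⇛var       = ε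
    ⇛⇒⟶βR* ⇛TYPE      = ε
    ⇛⇒⟶βR* ⇛KIND      = ε
    ⇛⇒⟶βR* (⇛Π a b)   = Π-↠ (⇛⇒⟶βR* a) (⇛⇒⟶βR* b)
    ⇛⇒⟶βR* (⇛ƛ a m)   = ƛ-↠ (⇛⇒⟶βR* a) (⇛⇒⟶βR* m)
    ⇛⇒⟶βR* (⇛· m n)   = ·-↠ (⇛⇒⟶βR* m) (⇛⇒⟶βR* n)
    ⇛⇒⟶βR* (⇛con ms)  = con-↠ (⇛L⇒⟶βR* ms)
    ⇛⇒⟶βR* (⇛β m n)   = ·-↠ (ƛ-↠ ε (⇛⇒⟶βR* m)) (⇛⇒⟶βR* n) ◅◅ top (β-step (beta _ _ _)) ◅ ε
    ⇛⇒⟶βR* (⇛El a)    = top (R-step (r-El a)) ◅ ε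
    ⇛⇒⟶βR* (⇛app r m n) = top (R-step (r-app r _ _ _ _ _ _)) ◅ ·-↠ (⇛⇒⟶βR* m) (⇛⇒⟶βR* n)

    ⇛L⇒⟶βR* : _⇛L_ ⇒ Star (ClL _↦βR_)
    ⇛L⇒⟶βR* []       = ε
    ⇛L⇒⟶βR* (m ∷ ms) = ∷-↠ (⇛⇒⟶βR* m) (⇛L⇒⟶βR* ms)

  confluence : Prop1-Confluence
  confluence = confluent-by-parallel ⟶βR⇒⇛ ⇛⇒⟶βR* ⇛-diamond

  -- Conversion

  church-rosser : _≡βR_ ⇒ Joinable _⟶βR_
  church-rosser = confluent⇒church-rosser confluence

  ≡βR-sym : ∀ {M N} → M ≡βR N → N ≡βR M
  ≡βR-sym = EqClosure.symmetric _⟶βR_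

  ⟶βR⇒≡βR : _⟶βR_ ⇒ _≡βR_
  ⟶βR⇒≡βR = EqClosure.return

  joinable⇒≡βR : ∀ {M N P} → M ⟶βR* P → N ⟶βR* P → M ≡βR N
  joinable⇒≡βR ps qs = a—↠b⇒a↔b ps ◅◅ a—↠b⇒b↔a qs

  ≡βR-sub : ∀ σ {M N} → M ≡βR N → sub σ M ≡βR sub σ N
  ≡βR-sub σ = EqClosure.gmap (sub σ) (Cl-sub ↦βR-stable σ)

  ≡βR-ren : ∀ ρ {M N} → M ≡βR N → ren ρ M ≡βR ren ρ N
  ≡βR-ren ρ = EqClosure.gmap (ren ρ) (Cl-ren ↦βR-stable ρ)

  ≡βR-[]₀ : ∀ M {N N′} → N ≡βR N′ → (M [ N ]₀) ≡βR (M [ N′ ]₀)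
  ≡βR-[]₀ M = EqClosure.gfold (EqClosure.isEquivalence _⟶βR_) (M [_]₀)
                (a—↠b⇒a↔b ∘ []₀-↠ ↦βR-stable M)

  Π-≡ : ∀ {A A′ B B′} → A ≡βR A′ → B ≡βR B′ → Π A B ≡βR Π A′ B′
  Π-≡ a b = EqClosure.gmap (λ A → Π A _) Π₁ a ◅◅ EqClosure.gmap (Π _) Π₂ b

  ·-≡ : ∀ {M M′ N N′} → M ≡βR M′ → N ≡βR N′ → (M · N) ≡βR (M′ · N′)
  ·-≡ m n = EqClosure.gmap (_· _) ·₁ m ◅◅ EqClosure.gmap (_ ·_) ·₂ n

  El-≡ : ∀ s {A A′} → A ≡βR A′ → El′ s A ≡βR El′ s A′
  El-≡ s = EqClosure.gmap (El′ s) (conₐ ∘ hd)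

  con₂-≡ : ∀ c {A A′ B B′} → A ≡βR A′ → B ≡βR B′ →
           con c (A ∷ B ∷ []) ≡βR con c (A′ ∷ B′ ∷ [])
  con₂-≡ c a b = EqClosure.gmap (λ A → con c (A ∷ _ ∷ [])) (conₐ ∘ hd) a
              ◅◅ EqClosure.gmap (λ B → con c (_ ∷ B ∷ [])) (conₐ ∘ tl ∘ hd) b

  Π-⟶βR* : ∀ {A B P} → Π A B ⟶βR* P → ∃₂ λ A′ B′ → P ≡ Π A′ B′ × A ⟶βR* A′ × B ⟶βR* B′
  Π-⟶βR* ε = _ , _ , refl , ε , ε
  Π-⟶βR* (top (β-step ()) ◅ rs)
  Π-⟶βR* (top (R-step ()) ◅ rs)
  Π-⟶βR* (Π₁ r ◅ rs) with Π-⟶βR* rs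
  ... | _ , _ , refl , as , bs = _ , _ , refl , r ◅ as , bs
  Π-⟶βR* (Π₂ r ◅ rs) with Π-⟶βR* rs
  ... | _ , _ , refl , as , bs = _ , _ , refl , as , r ◅ bs

  TYPE-⟶βR* : ∀ {P} → TYPE ⟶βR* P → P ≡ TYPE
  TYPE-⟶βR* ε = refl
  TYPE-⟶βR* (top (β-step ()) ◅ rs)
  TYPE-⟶βR* (top (R-step ()) ◅ rs)

  KIND-⟶βR* : ∀ {P} → KIND ⟶βR* P → P ≡ KIND
  KIND-⟶βR* ε = refl
  KIND-⟶βR* (top (β-step ()) ◅ rs)
  KIND-⟶βR* (top (R-step ()) ◅ rs)

  ElProd-⟶βR* : ∀ {s s₁ s₂ A B P} → El′ s (Prod′ s₁ s₂ A B) ⟶βR* P →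
    ∃₂ λ A′ B′ → P ≡ El′ s (Prod′ s₁ s₂ A′ B′) × A ⟶βR* A′ × B ⟶βR* B′
  ElProd-⟶βR* ε = _ , _ , refl , ε , ε
  ElProd-⟶βR* (top (β-step ()) ◅ rs)
  ElProd-⟶βR* (top (R-step ()) ◅ rs)
  ElProd-⟶βR* (conₐ (hd (top (β-step ()))) ◅ rs)
  ElProd-⟶βR* (conₐ (hd (top (R-step ()))) ◅ rs)
  ElProd-⟶βR* (conₐ (hd (conₐ (hd r))) ◅ rs) with ElProd-⟶βR* rs
  ... | _ , _ , refl , as , bs = _ , _ , refl , r ◅ as , bs
  ElProd-⟶βR* (conₐ (hd (conₐ (tl (hd r)))) ◅ rs) with ElProd-⟶βR* rs
  ... | _ , _ , refl , as , bs = _ , _ , refl , as , r ◅ bs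
  ElProd-⟶βR* (conₐ (hd (conₐ (tl (tl ())))) ◅ rs)
  ElProd-⟶βR* (conₐ (tl ()) ◅ rs)

  Π-injective : ∀ {A B A′ B′} → Π A B ≡βR Π A′ B′ → A ≡βR A′ × B ≡βR B′
  Π-injective e with church-rosser e
  ... | _ , ps , qs with Π-⟶βR* ps | Π-⟶βR* qs
  ... | _ , _ , refl , as , bs | _ , _ , refl , as′ , bs′ =
    joinable⇒≡βR as as′ , joinable⇒≡βR bs bs′

  ElProd-injective : ∀ {s s′ s₁ s₂ A B A′ B′} →
    El′ s (Prod′ s₁ s₂ A B) ≡βR El′ s′ (Prod′ s₁ s₂ A′ B′) → A ≡βR A′ × B ≡βR B′
  ElProd-injective e with church-rosser e
  ... | _ , ps , qs with ElProd-⟶βR* ps | ElProd-⟶βR* qs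
  ... | _ , _ , refl , as , bs | _ , _ , refl , as′ , bs′ =
    joinable⇒≡βR as as′ , joinable⇒≡βR bs bs′

  TYPE≢KIND : ¬ TYPE ≡βR KIND
  TYPE≢KIND e with church-rosser e
  ... | _ , ps , qs with TYPE-⟶βR* ps | KIND-⟶βR* qs
  ... | refl | ()

  TYPE≢Π : ∀ {A B} → ¬ TYPE ≡βR Π A B
  TYPE≢Π e with church-rosser e
  ... | _ , ps , qs with TYPE-⟶βR* ps | Π-⟶βR* qs
  ... | refl | _ , _ , () , _

  KIND≢Π : ∀ {A B} → ¬ KIND ≡βR Π A B
  KIND≢Π e with church-rosser e
  ... | _ , ps , qs with KIND-⟶βR* ps | Π-⟶βR* qs
  ... | refl | _ , _ , () , _

  -- Typing

  -- The typing rules with t-con instantiated at each entry of Σ_EPTS (so that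
  -- the argument types appear already substituted) and with the domain
  -- premise made explicit in ƛ; this makes inversion a matter of matching.
  infix 4 ⊢′_ _⊢′_∶_

  mutual
    data ⊢′_ : Ctx → Set where
      ⊢∅ : ⊢′ []
      ⊢∷ : ∀ {Γ A} → Γ ⊢′ A ∶ TYPE → ⊢′ (A ∷ Γ)

    data _⊢′_∶_ : Ctx → Tm → Tm → Set where
      ⊢sort : ∀ {Γ} → ⊢′ Γ → Γ ⊢′ TYPE ∶ KIND
      ⊢var  : ∀ {Γ i A} → ⊢′ Γ → Γ ∋ i ∶ A → Γ ⊢′ var i ∶ A
      ⊢U    : ∀ {Γ} s → ⊢′ Γ → Γ ⊢′ U′ s ∶ TYPE
      ⊢El   : ∀ {Γ A} s → ⊢′ Γ → Γ ⊢′ A ∶ U′ s → Γ ⊢′ El′ s A ∶ TYPE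
      ⊢u    : ∀ {Γ s₁ s₂} → ⊢′ Γ → Ax s₁ s₂ → Γ ⊢′ con (u s₁) [] ∶ U′ s₂
      ⊢Prod : ∀ {Γ s₁ s₂ s₃ A B} → ⊢′ Γ → Rl s₁ s₂ s₃ →
              Γ ⊢′ A ∶ U′ s₁ → Γ ⊢′ B ∶ Π (El′ s₁ A) (U′ s₂) →
              Γ ⊢′ Prod′ s₁ s₂ A B ∶ U′ s₃
      ⊢abs  : ∀ {Γ s₁ s₂ s₃ A B M} → ⊢′ Γ → Rl s₁ s₂ s₃ →
              Γ ⊢′ A ∶ U′ s₁ → Γ ⊢′ B ∶ Π (El′ s₁ A) (U′ s₂) →
              Γ ⊢′ M ∶ Π (El′ s₁ A) (El′ s₂ (ren suc B · var 0)) →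
              Γ ⊢′ con (abs s₁ s₂) (A ∷ B ∷ M ∷ []) ∶ El′ s₃ (Prod′ s₁ s₂ A B)
      ⊢app  : ∀ {Γ s₁ s₂ s₃ A B M N} → ⊢′ Γ → Rl s₁ s₂ s₃ →
              Γ ⊢′ A ∶ U′ s₁ → Γ ⊢′ B ∶ Π (El′ s₁ A) (U′ s₂) →
              Γ ⊢′ M ∶ El′ s₃ (Prod′ s₁ s₂ A B) → Γ ⊢′ N ∶ El′ s₁ A →
              Γ ⊢′ con (app s₁ s₂) (A ∷ B ∷ M ∷ N ∷ []) ∶ El′ s₂ (B · N)
      ⊢conv : ∀ {Γ M A B s} → Γ ⊢′ M ∶ A → IsSort s → Γ ⊢′ B ∶ s → A ≡βR B →
              Γ ⊢′ M ∶ B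
      ⊢Π    : ∀ {Γ A B s} → IsSort s → Γ ⊢′ A ∶ TYPE → (A ∷ Γ) ⊢′ B ∶ s →
              Γ ⊢′ Π A B ∶ s
      ⊢ƛ    : ∀ {Γ A B M s} → IsSort s → Γ ⊢′ A ∶ TYPE → (A ∷ Γ) ⊢′ B ∶ s →
              (A ∷ Γ) ⊢′ M ∶ B → Γ ⊢′ ƛ A M ∶ Π A B
      ⊢·    : ∀ {Γ M N A B} → Γ ⊢′ M ∶ Π A B → Γ ⊢′ N ∶ A → Γ ⊢′ M · N ∶ B [ N ]₀

  ⊢′-wf : ∀ {Γ M A} → Γ ⊢′ M ∶ A → ⊢′ Γ
  ⊢′-wf (⊢sort w)           = w
  ⊢′-wf (⊢var w x)          = w
  ⊢′-wf (⊢U s w)            = w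
  ⊢′-wf (⊢El s w A)         = w
  ⊢′-wf (⊢u w a)            = w
  ⊢′-wf (⊢Prod w r A B)     = w
  ⊢′-wf (⊢abs w r A B M)    = w
  ⊢′-wf (⊢app w r A B M N)  = w
  ⊢′-wf (⊢conv M s B c)     = ⊢′-wf M
  ⊢′-wf (⊢Π s A B)          = ⊢′-wf A
  ⊢′-wf (⊢ƛ s A B M)        = ⊢′-wf A
  ⊢′-wf (⊢· M N)            = ⊢′-wf M

  ⊢′-head : ∀ {Γ A} → ⊢′ (A ∷ Γ) → Γ ⊢′ A ∶ TYPE
  ⊢′-head (⊢∷ A) = A

  mutual
    ⊢′⇒⊢-wf : ∀ {Γ} → ⊢′ Γ → ⊢ Γ
    ⊢′⇒⊢-wf ⊢∅     = wf-∅
    ⊢′⇒⊢-wf (⊢∷ A) = wf-∷ (⊢′⇒⊢ A)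

    ⊢′⇒⊢ : ∀ {Γ M A} → Γ ⊢′ M ∶ A → Γ ⊢ M ∶ A
    ⊢′⇒⊢ (⊢sort w)          = t-sort (⊢′⇒⊢-wf w)
    ⊢′⇒⊢ (⊢var w x)         = t-var (⊢′⇒⊢-wf w) x
    ⊢′⇒⊢ (⊢U s w)           = t-U s (⊢′⇒⊢-wf w)
    ⊢′⇒⊢ (⊢El s w A)        = t-El s (⊢′⇒⊢-wf w) (⊢′⇒⊢ A)
    ⊢′⇒⊢ (⊢u w a)           = t-con (⊢′⇒⊢-wf w) (σ-u a) a-∅
    ⊢′⇒⊢ (⊢Prod w r A B)    = t-Prod (⊢′⇒⊢-wf w) r (⊢′⇒⊢ A) (⊢′⇒⊢ B)
    ⊢′⇒⊢ (⊢abs w r A B M)   =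
      t-con (⊢′⇒⊢-wf w) (σ-abs r) (a-∷ (a-∷ (a-∷ a-∅ (⊢′⇒⊢ A)) (⊢′⇒⊢ B)) (⊢′⇒⊢ M))
    ⊢′⇒⊢ (⊢app w r A B M N) =
      t-con (⊢′⇒⊢-wf w) (σ-app r)
        (a-∷ (a-∷ (a-∷ (a-∷ a-∅ (⊢′⇒⊢ A)) (⊢′⇒⊢ B)) (⊢′⇒⊢ M)) (⊢′⇒⊢ N))
    ⊢′⇒⊢ (⊢conv M s B c)    = t-conv (⊢′⇒⊢ M) s (⊢′⇒⊢ B) c
    ⊢′⇒⊢ (⊢Π s A B)         = t-Π s (⊢′⇒⊢ A) (⊢′⇒⊢ B)
    ⊢′⇒⊢ (⊢ƛ s A B M)       = t-ƛ s (⊢′⇒⊢ B) (⊢′⇒⊢ M)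
    ⊢′⇒⊢ (⊢· M N)           = t-app (⊢′⇒⊢ M) (⊢′⇒⊢ N)

  mutual
    ⊢⇒⊢′-wf : ∀ {Γ} → ⊢ Γ → ⊢′ Γ
    ⊢⇒⊢′-wf wf-∅     = ⊢∅
    ⊢⇒⊢′-wf (wf-∷ A) = ⊢∷ (⊢⇒⊢′ A)

    ⊢⇒⊢′ : ∀ {Γ M A} → Γ ⊢ M ∶ A → Γ ⊢′ M ∶ A
    ⊢⇒⊢′ (t-sort w)   = ⊢sort (⊢⇒⊢′-wf w)
    ⊢⇒⊢′ (t-var w x)  = ⊢var (⊢⇒⊢′-wf w) x
    ⊢⇒⊢′ (t-con w (σ-U s) a-∅)            = ⊢U s (⊢⇒⊢′-wf w)
    ⊢⇒⊢′ (t-con w (σ-El s) (a-∷ a-∅ A))   = ⊢El s (⊢⇒⊢′-wf w) (⊢⇒⊢′ A)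
    ⊢⇒⊢′ (t-con w (σ-u a) a-∅)            = ⊢u (⊢⇒⊢′-wf w) a
    ⊢⇒⊢′ (t-con w (σ-Prod r) (a-∷ (a-∷ a-∅ A) B)) =
      ⊢Prod (⊢⇒⊢′-wf w) r (⊢⇒⊢′ A) (⊢⇒⊢′ B)
    ⊢⇒⊢′ (t-con w (σ-abs r) (a-∷ (a-∷ (a-∷ a-∅ A) B) M)) =
      ⊢abs (⊢⇒⊢′-wf w) r (⊢⇒⊢′ A) (⊢⇒⊢′ B) (⊢⇒⊢′ M)
    ⊢⇒⊢′ (t-con w (σ-app r) (a-∷ (a-∷ (a-∷ (a-∷ a-∅ A) B) M) N)) =
      ⊢app (⊢⇒⊢′-wf w) r (⊢⇒⊢′ A) (⊢⇒⊢′ B) (⊢⇒⊢′ M) (⊢⇒⊢′ N)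
    ⊢⇒⊢′ (t-conv M s B c) = ⊢conv (⊢⇒⊢′ M) s (⊢⇒⊢′ B) c
    ⊢⇒⊢′ (t-Π s A B)      = ⊢Π s (⊢⇒⊢′ A) (⊢⇒⊢′ B)
    ⊢⇒⊢′ (t-ƛ s B M)      = let B′ = ⊢⇒⊢′ B in ⊢ƛ s (⊢′-head (⊢′-wf B′)) B′ (⊢⇒⊢′ M)
    ⊢⇒⊢′ (t-app M N)      = ⊢· (⊢⇒⊢′ M) (⊢⇒⊢′ N)

  RenTyped : Ctx → Ctx → Ren → Set
  RenTyped Γ Δ ρ = ∀ {x A} → Γ ∋ x ∶ A → Δ ∋ ρ x ∶ ren ρ A

  ren-suc-ext : ∀ ρ A → ren suc (ren ρ A) ≡ ren (ext ρ) (ren suc A)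
  ren-suc-ext ρ A = trans (ren-ren suc ρ A) (sym (ren-ren (ext ρ) suc A))

  RenTyped-ext : ∀ {Γ Δ ρ A} → RenTyped Γ Δ ρ → RenTyped (A ∷ Γ) (ren ρ A ∷ Δ) (ext ρ)
  RenTyped-ext {Δ = Δ} {ρ} {A} t here =
    subst ((ren ρ A ∷ Δ) ∋ zero ∶_) (ren-suc-ext ρ A) here
  RenTyped-ext {Δ = Δ} {ρ} {A} t (there {A = A′} {i = i} x) =
    subst ((ren ρ A ∷ Δ) ∋ suc (ρ i) ∶_) (ren-suc-ext ρ A′) (there (t x))

  ⊢′-ren : ∀ {Γ Δ ρ M A} → Γ ⊢′ M ∶ A → ⊢′ Δ → RenTyped Γ Δ ρ → Δ ⊢′ ren ρ M ∶ ren ρ A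
  ⊢′-ren (⊢sort w)         w′ t = ⊢sort w′
  ⊢′-ren (⊢var w x)        w′ t = ⊢var w′ (t x)
  ⊢′-ren (⊢U s w)          w′ t = ⊢U s w′
  ⊢′-ren (⊢El s w A)       w′ t = ⊢El s w′ (⊢′-ren A w′ t)
  ⊢′-ren (⊢u w a)          w′ t = ⊢u w′ a
  ⊢′-ren (⊢Prod w r A B)   w′ t = ⊢Prod w′ r (⊢′-ren A w′ t) (⊢′-ren B w′ t)
  ⊢′-ren {ρ = ρ} (⊢abs {s₁ = s₁} {s₂} {A = A} {B} w r ⊢A ⊢B ⊢M) w′ t =
    ⊢abs w′ r (⊢′-ren ⊢A w′ t) (⊢′-ren ⊢B w′ t)
      (subst (λ X → _ ⊢′ _ ∶ Π (El′ s₁ (ren ρ A)) (El′ s₂ (X · var 0)))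
             (sym (ren-suc-ext ρ B)) (⊢′-ren ⊢M w′ t))
  ⊢′-ren (⊢app w r A B M N) w′ t =
    ⊢app w′ r (⊢′-ren A w′ t) (⊢′-ren B w′ t) (⊢′-ren M w′ t) (⊢′-ren N w′ t)
  ⊢′-ren (⊢conv M sTYPE B c) w′ t = ⊢conv (⊢′-ren M w′ t) sTYPE (⊢′-ren B w′ t) (≡βR-ren _ c)
  ⊢′-ren (⊢conv M sKIND B c) w′ t = ⊢conv (⊢′-ren M w′ t) sKIND (⊢′-ren B w′ t) (≡βR-ren _ c)
  ⊢′-ren (⊢Π sTYPE A B) w′ t =
    let A′ = ⊢′-ren A w′ t in ⊢Π sTYPE A′ (⊢′-ren B (⊢∷ A′) (RenTyped-ext t))
  ⊢′-ren (⊢Π sKIND A B) w′ t =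
    let A′ = ⊢′-ren A w′ t in ⊢Π sKIND A′ (⊢′-ren B (⊢∷ A′) (RenTyped-ext t))
  ⊢′-ren (⊢ƛ sTYPE A B M) w′ t =
    let A′ = ⊢′-ren A w′ t in
    ⊢ƛ sTYPE A′ (⊢′-ren B (⊢∷ A′) (RenTyped-ext t)) (⊢′-ren M (⊢∷ A′) (RenTyped-ext t))
  ⊢′-ren (⊢ƛ sKIND A B M) w′ t =
    let A′ = ⊢′-ren A w′ t in
    ⊢ƛ sKIND A′ (⊢′-ren B (⊢∷ A′) (RenTyped-ext t)) (⊢′-ren M (⊢∷ A′) (RenTyped-ext t))
  ⊢′-ren {ρ = ρ} (⊢· {N = N} {B = B} M N′) w′ t =
    subst (_ ⊢′ _ ∶_) (sym (ren-[]₀ ρ N B)) (⊢· (⊢′-ren M w′ t) (⊢′-ren N′ w′ t))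

  ⊢′-weaken : ∀ {Γ M A B} → Γ ⊢′ M ∶ A → Γ ⊢′ B ∶ TYPE → (B ∷ Γ) ⊢′ ren suc M ∶ ren suc A
  ⊢′-weaken M B = ⊢′-ren M (⊢∷ B) there

  SubTyped : Ctx → Ctx → Sub → Set
  SubTyped Γ Δ σ = ∀ {x A} → Γ ∋ x ∶ A → Δ ⊢′ σ x ∶ sub σ A

  ren-suc-exts : ∀ σ A → ren suc (sub σ A) ≡ sub (exts σ) (ren suc A)
  ren-suc-exts σ A = trans (ren-sub suc σ A) (sym (sub-ren (exts σ) suc A))

  SubTyped-exts : ∀ {Γ Δ σ A} → Δ ⊢′ sub σ A ∶ TYPE → SubTyped Γ Δ σ →
                  SubTyped (A ∷ Γ) (sub σ A ∷ Δ) (exts σ)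
  SubTyped-exts {Δ = Δ} {σ} {A} ⊢A t here =
    subst ((sub σ A ∷ Δ) ⊢′ var zero ∶_) (ren-suc-exts σ A) (⊢var (⊢∷ ⊢A) here)
  SubTyped-exts {σ = σ} ⊢A t (there {A = A′} x) =
    subst (_ ⊢′ _ ∶_) (ren-suc-exts σ A′) (⊢′-weaken (t x) ⊢A)

  ⊢′-sub : ∀ {Γ Δ σ M A} → Γ ⊢′ M ∶ A → ⊢′ Δ → SubTyped Γ Δ σ → Δ ⊢′ sub σ M ∶ sub σ A
  ⊢′-sub (⊢sort w)         w′ t = ⊢sort w′
  ⊢′-sub (⊢var w x)        w′ t = t x
  ⊢′-sub (⊢U s w)          w′ t = ⊢U s w′
  ⊢′-sub (⊢El s w A)       w′ t = ⊢El s w′ (⊢′-sub A w′ t)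
  ⊢′-sub (⊢u w a)          w′ t = ⊢u w′ a
  ⊢′-sub (⊢Prod w r A B)   w′ t = ⊢Prod w′ r (⊢′-sub A w′ t) (⊢′-sub B w′ t)
  ⊢′-sub {σ = σ} (⊢abs {s₁ = s₁} {s₂} {A = A} {B} w r ⊢A ⊢B ⊢M) w′ t =
    ⊢abs w′ r (⊢′-sub ⊢A w′ t) (⊢′-sub ⊢B w′ t)
      (subst (λ X → _ ⊢′ _ ∶ Π (El′ s₁ (sub σ A)) (El′ s₂ (X · var 0)))
             (sym (ren-suc-exts σ B)) (⊢′-sub ⊢M w′ t))
  ⊢′-sub (⊢app w r A B M N) w′ t =
    ⊢app w′ r (⊢′-sub A w′ t) (⊢′-sub B w′ t) (⊢′-sub M w′ t) (⊢′-sub N w′ t)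
  ⊢′-sub (⊢conv M sTYPE B c) w′ t = ⊢conv (⊢′-sub M w′ t) sTYPE (⊢′-sub B w′ t) (≡βR-sub _ c)
  ⊢′-sub (⊢conv M sKIND B c) w′ t = ⊢conv (⊢′-sub M w′ t) sKIND (⊢′-sub B w′ t) (≡βR-sub _ c)
  ⊢′-sub (⊢Π sTYPE A B) w′ t =
    let A′ = ⊢′-sub A w′ t in ⊢Π sTYPE A′ (⊢′-sub B (⊢∷ A′) (SubTyped-exts A′ t))
  ⊢′-sub (⊢Π sKIND A B) w′ t =
    let A′ = ⊢′-sub A w′ t in ⊢Π sKIND A′ (⊢′-sub B (⊢∷ A′) (SubTyped-exts A′ t))
  ⊢′-sub (⊢ƛ sTYPE A B M) w′ t =
    let A′ = ⊢′-sub A w′ t in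
    ⊢ƛ sTYPE A′ (⊢′-sub B (⊢∷ A′) (SubTyped-exts A′ t)) (⊢′-sub M (⊢∷ A′) (SubTyped-exts A′ t))
  ⊢′-sub (⊢ƛ sKIND A B M) w′ t =
    let A′ = ⊢′-sub A w′ t in
    ⊢ƛ sKIND A′ (⊢′-sub B (⊢∷ A′) (SubTyped-exts A′ t)) (⊢′-sub M (⊢∷ A′) (SubTyped-exts A′ t))
  ⊢′-sub {σ = σ} (⊢· {N = N} {B = B} M N′) w′ t =
    subst (_ ⊢′ _ ∶_) (sym (sub-[]₀ σ N B)) (⊢· (⊢′-sub M w′ t) (⊢′-sub N′ w′ t))

  ⊢′-[]₀ : ∀ {Γ N A M B} → Γ ⊢′ N ∶ A → (A ∷ Γ) ⊢′ M ∶ B → Γ ⊢′ M [ N ]₀ ∶ B [ N ]₀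
  ⊢′-[]₀ {Γ} {N} {A} ⊢N ⊢M = ⊢′-sub ⊢M (⊢′-wf ⊢N) single-typed
    where
    single-typed : SubTyped (A ∷ Γ) Γ (single N)
    single-typed here = subst (Γ ⊢′ N ∶_) (sym (ren-suc-[]₀ N A)) ⊢N
    single-typed (there {A = A′} x) =
      subst (Γ ⊢′ _ ∶_) (sym (ren-suc-[]₀ N A′)) (⊢var (⊢′-wf ⊢N) x)

  ⊢′-[]₀-sort : ∀ {Γ N A B s} → IsSort s → Γ ⊢′ N ∶ A → (A ∷ Γ) ⊢′ B ∶ s → Γ ⊢′ B [ N ]₀ ∶ s
  ⊢′-[]₀-sort sTYPE = ⊢′-[]₀
  ⊢′-[]₀-sort sKIND = ⊢′-[]₀

  ⊢′-ctx-conv : ∀ {Γ A A′ M B} → (A ∷ Γ) ⊢′ M ∶ B → Γ ⊢′ A′ ∶ TYPE → A′ ≡βR A → (A′ ∷ Γ) ⊢′ M ∶ B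
  ⊢′-ctx-conv {Γ} {A} {A′} {M} {B} ⊢M ⊢A′ e =
    subst₂ ((A′ ∷ Γ) ⊢′_∶_) (sub-var (λ _ → refl) M) (sub-var (λ _ → refl) B)
      (⊢′-sub ⊢M (⊢∷ ⊢A′) var-typed)
    where
    var-typed : SubTyped (A ∷ Γ) (A′ ∷ Γ) var
    var-typed here = subst (_ ⊢′ _ ∶_) (sym (sub-var (λ _ → refl) _))
      (⊢conv (⊢var (⊢∷ ⊢A′) here) sTYPE (⊢′-weaken (⊢′-head (⊢′-wf ⊢M)) ⊢A′) (≡βR-ren suc e))
    var-typed (there x) = subst (_ ⊢′ _ ∶_) (sym (sub-var (λ _ → refl) _)) (⊢var (⊢∷ ⊢A′) (there x))

  ∋-typed : ∀ {Γ x A} → ⊢′ Γ → Γ ∋ x ∶ A → Γ ⊢′ A ∶ TYPE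
  ∋-typed (⊢∷ ⊢A) here      = ⊢′-weaken ⊢A ⊢A
  ∋-typed (⊢∷ ⊢A) (there x) = ⊢′-weaken (∋-typed (⊢′-wf ⊢A) x) ⊢A

  Π-inversion : ∀ {Γ A B T} → Γ ⊢′ Π A B ∶ T →
                Γ ⊢′ A ∶ TYPE × ∃ λ s → IsSort s × (A ∷ Γ) ⊢′ B ∶ s
  Π-inversion (⊢conv d s e c) = Π-inversion d
  Π-inversion (⊢Π s ⊢A ⊢B)    = ⊢A , _ , s , ⊢B

  ƛ-inversion : ∀ {Γ A M T} → Γ ⊢′ ƛ A M ∶ T →
    ∃₂ λ B s → IsSort s × Γ ⊢′ A ∶ TYPE × (A ∷ Γ) ⊢′ B ∶ s × (A ∷ Γ) ⊢′ M ∶ B × Π A B ≡βR T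
  ƛ-inversion (⊢ƛ s ⊢A ⊢B ⊢M) = _ , _ , s , ⊢A , ⊢B , ⊢M , ε
  ƛ-inversion (⊢conv d s e c) with ƛ-inversion d
  ... | B , s′ , s″ , ⊢A , ⊢B , ⊢M , e′ = B , s′ , s″ , ⊢A , ⊢B , ⊢M , e′ ◅◅ c

  ·-inversion : ∀ {Γ M N T} → Γ ⊢′ M · N ∶ T → ∃₂ λ A B → Γ ⊢′ M ∶ Π A B × Γ ⊢′ N ∶ A
  ·-inversion (⊢conv d s e c) = ·-inversion d
  ·-inversion (⊢· ⊢M ⊢N)      = _ , _ , ⊢M , ⊢N

  abs-inversion : ∀ {Γ s₁ s₂ A B M T} → Γ ⊢′ con (abs s₁ s₂) (A ∷ B ∷ M ∷ []) ∶ T →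
    ∃ λ s₃ → Rl s₁ s₂ s₃ × Γ ⊢′ A ∶ U′ s₁ × Γ ⊢′ B ∶ Π (El′ s₁ A) (U′ s₂) ×
      Γ ⊢′ M ∶ Π (El′ s₁ A) (El′ s₂ (ren suc B · var 0)) × El′ s₃ (Prod′ s₁ s₂ A B) ≡βR T
  abs-inversion (⊢abs w r ⊢A ⊢B ⊢M) = _ , r , ⊢A , ⊢B , ⊢M , ε
  abs-inversion (⊢conv d s e c) with abs-inversion d
  ... | s₃ , r , ⊢A , ⊢B , ⊢M , e′ = s₃ , r , ⊢A , ⊢B , ⊢M , e′ ◅◅ c

  app-inversion : ∀ {Γ s₁ s₂ A B M N T} → Γ ⊢′ con (app s₁ s₂) (A ∷ B ∷ M ∷ N ∷ []) ∶ T →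
                  ∃ λ T′ → Γ ⊢′ M ∶ T′
  app-inversion (⊢app w r ⊢A ⊢B ⊢M ⊢N) = _ , ⊢M
  app-inversion (⊢conv d s e c)         = app-inversion d

  mutual
    validity : ∀ {Γ M T} → Γ ⊢′ M ∶ T → T ≡ KIND ⊎ ∃ λ s → IsSort s × Γ ⊢′ T ∶ s
    validity (⊢sort w)              = inj₁ refl
    validity (⊢var w x)             = inj₂ (_ , sTYPE , ∋-typed w x)
    validity (⊢U s w)               = inj₂ (_ , sKIND , ⊢sort w)
    validity (⊢El s w ⊢A)           = inj₂ (_ , sKIND , ⊢sort w)
    validity (⊢u w a)               = inj₂ (_ , sTYPE , ⊢U _ w)
    validity (⊢Prod w r ⊢A ⊢B)      = inj₂ (_ , sTYPE , ⊢U _ w)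
    validity (⊢abs w r ⊢A ⊢B ⊢M)    = inj₂ (_ , sTYPE , ⊢El _ w (⊢Prod w r ⊢A ⊢B))
    validity (⊢app w r ⊢A ⊢B ⊢M ⊢N) = inj₂ (_ , sTYPE , ⊢El _ w (⊢· ⊢B ⊢N))
    validity (⊢conv d s e c)        = inj₂ (_ , s , e)
    validity (⊢Π sTYPE ⊢A ⊢B)       = inj₂ (_ , sKIND , ⊢sort (⊢′-wf ⊢A))
    validity (⊢Π sKIND ⊢A ⊢B)       = inj₁ refl
    validity (⊢ƛ s ⊢A ⊢B ⊢M)        = inj₂ (_ , s , ⊢Π s ⊢A ⊢B)
    validity (⊢· ⊢M ⊢N)             = inj₂ (codomain-[]₀-typed ⊢M ⊢N)

    codomain-[]₀-typed : ∀ {Γ M N A B} → Γ ⊢′ M ∶ Π A B → Γ ⊢′ N ∶ A →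
                         ∃ λ s → IsSort s × Γ ⊢′ B [ N ]₀ ∶ s
    codomain-[]₀-typed ⊢M ⊢N with validity ⊢M
    ... | inj₂ (_ , _ , ⊢ΠAB) with Π-inversion ⊢ΠAB
    ...   | _ , _ , s , ⊢B = _ , s , ⊢′-[]₀-sort s ⊢N ⊢B

  ⊢′-ΠElU : ∀ {Γ A s₁ s₂} → Γ ⊢′ A ∶ U′ s₁ → Γ ⊢′ Π (El′ s₁ A) (U′ s₂) ∶ TYPE
  ⊢′-ΠElU {s₁ = s₁} {s₂} ⊢A = ⊢Π sTYPE El-A (⊢U s₂ (⊢∷ El-A))
    where El-A = ⊢El s₁ (⊢′-wf ⊢A) ⊢A

  ⊢′-ΠElEl : ∀ {Γ A B s₁ s₂} → Γ ⊢′ A ∶ U′ s₁ → Γ ⊢′ B ∶ Π (El′ s₁ A) (U′ s₂) →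
             Γ ⊢′ Π (El′ s₁ A) (El′ s₂ (ren suc B · var 0)) ∶ TYPE
  ⊢′-ΠElEl {s₁ = s₁} {s₂} ⊢A ⊢B =
    ⊢Π sTYPE El-A (⊢El s₂ (⊢∷ El-A) (⊢· (⊢′-weaken ⊢B El-A) (⊢var (⊢∷ El-A) here)))
    where El-A = ⊢El s₁ (⊢′-wf ⊢A) ⊢A

  -- Subject reduction

  family-domain-⟶βR : ∀ {Γ A A′ B s₁ s₂} → Γ ⊢′ A′ ∶ U′ s₁ → A ⟶βR A′ →
    Γ ⊢′ B ∶ Π (El′ s₁ A) (U′ s₂) → Γ ⊢′ B ∶ Π (El′ s₁ A′) (U′ s₂)
  family-domain-⟶βR ⊢A′ st ⊢B = ⊢conv ⊢B sTYPE (⊢′-ΠElU ⊢A′) (Π-≡ (El-≡ _ (⟶βR⇒≡βR st)) ε)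

  mutual
    subject-reduction : ∀ {Γ M M′ T} → Γ ⊢′ M ∶ T → M ⟶βR M′ → Γ ⊢′ M′ ∶ T
    subject-reduction (⊢sort w)  (top (β-step ()))
    subject-reduction (⊢sort w)  (top (R-step ()))
    subject-reduction (⊢var w x) (top (β-step ()))
    subject-reduction (⊢var w x) (top (R-step ()))
    subject-reduction (⊢U s w)   (top (β-step ()))
    subject-reduction (⊢U s w)   (top (R-step ()))
    subject-reduction (⊢U s w)   (conₐ ())
    subject-reduction (⊢u w a)   (top (β-step ()))
    subject-reduction (⊢u w a)   (top (R-step ()))
    subject-reduction (⊢u w a)   (conₐ ())
    subject-reduction (⊢El s w ⊢A)           st = El-⟶βR w ⊢A st
    subject-reduction (⊢Prod w r ⊢A ⊢B)      st = Prod-⟶βR w r ⊢A ⊢B st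
    subject-reduction (⊢abs w r ⊢A ⊢B ⊢M)    st = abs-⟶βR w r ⊢A ⊢B ⊢M st
    subject-reduction (⊢app w r ⊢A ⊢B ⊢M ⊢N) st = app-⟶βR w r ⊢A ⊢B ⊢M ⊢N st
    subject-reduction (⊢conv d s e c)        st = ⊢conv (subject-reduction d st) s e c
    subject-reduction (⊢Π s ⊢A ⊢B)           st = Π-⟶βR s ⊢A ⊢B st
    subject-reduction (⊢ƛ s ⊢A ⊢B ⊢M)        st = ƛ-⟶βR s ⊢A ⊢B ⊢M st
    subject-reduction (⊢· ⊢M ⊢N)             st = ·-⟶βR ⊢M ⊢N st

    El-⟶βR : ∀ {Γ A X s} → ⊢′ Γ → Γ ⊢′ A ∶ U′ s → El′ s A ⟶βR X → Γ ⊢′ X ∶ TYPE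
    El-⟶βR w ⊢A (top (β-step ()))
    El-⟶βR w ⊢A (top (R-step (r-El a))) = ⊢U _ w
    El-⟶βR w ⊢A (conₐ (hd st))          = ⊢El _ w (subject-reduction ⊢A st)
    El-⟶βR w ⊢A (conₐ (tl ()))

    Prod-⟶βR : ∀ {Γ A B X s₁ s₂ s₃} → ⊢′ Γ → Rl s₁ s₂ s₃ → Γ ⊢′ A ∶ U′ s₁ →
      Γ ⊢′ B ∶ Π (El′ s₁ A) (U′ s₂) → Prod′ s₁ s₂ A B ⟶βR X → Γ ⊢′ X ∶ U′ s₃
    Prod-⟶βR w r ⊢A ⊢B (top (β-step ()))
    Prod-⟶βR w r ⊢A ⊢B (top (R-step ()))
    Prod-⟶βR w r ⊢A ⊢B (conₐ (hd st)) = ⊢Prod w r ⊢A′ (family-domain-⟶βR ⊢A′ st ⊢B)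
      where ⊢A′ = subject-reduction ⊢A st
    Prod-⟶βR w r ⊢A ⊢B (conₐ (tl (hd st))) = ⊢Prod w r ⊢A (subject-reduction ⊢B st)
    Prod-⟶βR w r ⊢A ⊢B (conₐ (tl (tl ())))

    abs-⟶βR : ∀ {Γ A B M X s₁ s₂ s₃} → ⊢′ Γ → Rl s₁ s₂ s₃ → Γ ⊢′ A ∶ U′ s₁ →
      Γ ⊢′ B ∶ Π (El′ s₁ A) (U′ s₂) → Γ ⊢′ M ∶ Π (El′ s₁ A) (El′ s₂ (ren suc B · var 0)) →
      con (abs s₁ s₂) (A ∷ B ∷ M ∷ []) ⟶βR X → Γ ⊢′ X ∶ El′ s₃ (Prod′ s₁ s₂ A B)
    abs-⟶βR w r ⊢A ⊢B ⊢M (top (β-step ()))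
    abs-⟶βR w r ⊢A ⊢B ⊢M (top (R-step ()))
    abs-⟶βR w r ⊢A ⊢B ⊢M (conₐ (hd st)) =
      ⊢conv (⊢abs w r ⊢A′ ⊢B′ ⊢M′) sTYPE (⊢El _ w (⊢Prod w r ⊢A ⊢B)) (El-≡ _ (con₂-≡ _ (≡βR-sym e) ε))
      where
      e   = ⟶βR⇒≡βR st
      ⊢A′ = subject-reduction ⊢A st
      ⊢B′ = family-domain-⟶βR ⊢A′ st ⊢B
      ⊢M′ = ⊢conv ⊢M sTYPE (⊢′-ΠElEl ⊢A′ ⊢B′) (Π-≡ (El-≡ _ e) ε)
    abs-⟶βR w r ⊢A ⊢B ⊢M (conₐ (tl (hd st))) =
      ⊢conv (⊢abs w r ⊢A ⊢B′ ⊢M′) sTYPE (⊢El _ w (⊢Prod w r ⊢A ⊢B)) (El-≡ _ (con₂-≡ _ ε (≡βR-sym e)))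
      where
      e   = ⟶βR⇒≡βR st
      ⊢B′ = subject-reduction ⊢B st
      ⊢M′ = ⊢conv ⊢M sTYPE (⊢′-ΠElEl ⊢A ⊢B′) (Π-≡ ε (El-≡ _ (·-≡ (≡βR-ren suc e) ε)))
    abs-⟶βR w r ⊢A ⊢B ⊢M (conₐ (tl (tl (hd st)))) = ⊢abs w r ⊢A ⊢B (subject-reduction ⊢M st)
    abs-⟶βR w r ⊢A ⊢B ⊢M (conₐ (tl (tl (tl ()))))

    app-⟶βR : ∀ {Γ A B M N X s₁ s₂ s₃} → ⊢′ Γ → Rl s₁ s₂ s₃ → Γ ⊢′ A ∶ U′ s₁ →
      Γ ⊢′ B ∶ Π (El′ s₁ A) (U′ s₂) → Γ ⊢′ M ∶ El′ s₃ (Prod′ s₁ s₂ A B) → Γ ⊢′ N ∶ El′ s₁ A →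
      con (app s₁ s₂) (A ∷ B ∷ M ∷ N ∷ []) ⟶βR X → Γ ⊢′ X ∶ El′ s₂ (B · N)
    app-⟶βR w r ⊢A ⊢B ⊢M ⊢N (top (β-step ()))
    app-⟶βR {B = B} {N = N} {s₁ = s₁} {s₂} w r ⊢A ⊢B ⊢M ⊢N (top (R-step (r-app _ _ _ _ _ _ _)))
      with abs-inversion ⊢M
    ... | _ , _ , _ , _ , ⊢P , e with ElProd-injective e
    ...   | eA , eB = subst (λ X → _ ⊢′ _ ∶ El′ s₂ (X · N)) (ren-suc-[]₀ N B) (⊢· ⊢P′ ⊢N)
      where
      ⊢P′ = ⊢conv ⊢P sTYPE (⊢′-ΠElEl ⊢A ⊢B) (Π-≡ (El-≡ s₁ eA) (El-≡ s₂ (·-≡ (≡βR-ren suc eB) ε)))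
    app-⟶βR {s₃ = s₃} w r ⊢A ⊢B ⊢M ⊢N (conₐ (hd st)) = ⊢app w r ⊢A′ ⊢B′ ⊢M′ ⊢N′
      where
      e   = ⟶βR⇒≡βR st
      ⊢A′ = subject-reduction ⊢A st
      ⊢B′ = family-domain-⟶βR ⊢A′ st ⊢B
      ⊢M′ = ⊢conv ⊢M sTYPE (⊢El s₃ w (⊢Prod w r ⊢A′ ⊢B′)) (El-≡ s₃ (con₂-≡ _ e ε))
      ⊢N′ = ⊢conv ⊢N sTYPE (⊢El _ w ⊢A′) (El-≡ _ e)
    app-⟶βR {s₃ = s₃} w r ⊢A ⊢B ⊢M ⊢N (conₐ (tl (hd st))) =
      ⊢conv (⊢app w r ⊢A ⊢B′ ⊢M′ ⊢N) sTYPE (⊢El _ w (⊢· ⊢B ⊢N)) (El-≡ _ (·-≡ (≡βR-sym e) ε))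
      where
      e   = ⟶βR⇒≡βR st
      ⊢B′ = subject-reduction ⊢B st
      ⊢M′ = ⊢conv ⊢M sTYPE (⊢El s₃ w (⊢Prod w r ⊢A ⊢B′)) (El-≡ s₃ (con₂-≡ _ ε e))
    app-⟶βR w r ⊢A ⊢B ⊢M ⊢N (conₐ (tl (tl (hd st)))) = ⊢app w r ⊢A ⊢B (subject-reduction ⊢M st) ⊢N
    app-⟶βR w r ⊢A ⊢B ⊢M ⊢N (conₐ (tl (tl (tl (hd st))))) =
      ⊢conv (⊢app w r ⊢A ⊢B ⊢M (subject-reduction ⊢N st)) sTYPE (⊢El _ w (⊢· ⊢B ⊢N))
        (El-≡ _ (·-≡ ε (≡βR-sym (⟶βR⇒≡βR st))))
    app-⟶βR w r ⊢A ⊢B ⊢M ⊢N (conₐ (tl (tl (tl (tl ())))))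

    Π-⟶βR : ∀ {Γ A B X s} → IsSort s → Γ ⊢′ A ∶ TYPE → (A ∷ Γ) ⊢′ B ∶ s → Π A B ⟶βR X → Γ ⊢′ X ∶ s
    Π-⟶βR s ⊢A ⊢B (top (β-step ()))
    Π-⟶βR s ⊢A ⊢B (top (R-step ()))
    Π-⟶βR s ⊢A ⊢B (Π₁ st) = ⊢Π s ⊢A′ (⊢′-ctx-conv ⊢B ⊢A′ (≡βR-sym (⟶βR⇒≡βR st)))
      where ⊢A′ = subject-reduction ⊢A st
    Π-⟶βR s ⊢A ⊢B (Π₂ st) = ⊢Π s ⊢A (subject-reduction ⊢B st)

    ƛ-⟶βR : ∀ {Γ A B M X s} → IsSort s → Γ ⊢′ A ∶ TYPE → (A ∷ Γ) ⊢′ B ∶ s → (A ∷ Γ) ⊢′ M ∶ B →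
            ƛ A M ⟶βR X → Γ ⊢′ X ∶ Π A B
    ƛ-⟶βR s ⊢A ⊢B ⊢M (top (β-step ()))
    ƛ-⟶βR s ⊢A ⊢B ⊢M (top (R-step ()))
    ƛ-⟶βR s ⊢A ⊢B ⊢M (ƛ₁ st) =
      ⊢conv (⊢ƛ s ⊢A′ (⊢′-ctx-conv ⊢B ⊢A′ e) (⊢′-ctx-conv ⊢M ⊢A′ e)) s (⊢Π s ⊢A ⊢B) (Π-≡ e ε)
      where
      e   = ≡βR-sym (⟶βR⇒≡βR st)
      ⊢A′ = subject-reduction ⊢A st
    ƛ-⟶βR s ⊢A ⊢B ⊢M (ƛ₂ st) = ⊢ƛ s ⊢A ⊢B (subject-reduction ⊢M st)

    ·-⟶βR : ∀ {Γ M N A B X} → Γ ⊢′ M ∶ Π A B → Γ ⊢′ N ∶ A → (M · N) ⟶βR X → Γ ⊢′ X ∶ B [ N ]₀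
    ·-⟶βR ⊢M ⊢N (top (R-step ()))
    ·-⟶βR ⊢M ⊢N (top (β-step (beta _ _ _)))
      with ƛ-inversion ⊢M | codomain-[]₀-typed ⊢M ⊢N
    ... | _ , _ , _ , ⊢A , _ , ⊢P , e | _ , s , ⊢B[N] with Π-injective e
    ...   | eA , eB = ⊢conv (⊢′-[]₀ (⊢conv ⊢N sTYPE ⊢A (≡βR-sym eA)) ⊢P) s ⊢B[N] (≡βR-sub _ eB)
    ·-⟶βR ⊢M ⊢N (·₁ st) = ⊢· (subject-reduction ⊢M st) ⊢N
    ·-⟶βR {B = B} ⊢M ⊢N (·₂ st) with codomain-[]₀-typed ⊢M ⊢N
    ... | _ , s , ⊢B[N] = ⊢conv (⊢· ⊢M (subject-reduction ⊢N st)) s ⊢B[N]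
                                (≡βR-sym (≡βR-[]₀ B (⟶βR⇒≡βR st)))

  subject-reduction* : ∀ {Γ M M′ T} → Γ ⊢′ M ∶ T → M ⟶βR* M′ → Γ ⊢′ M′ ∶ T
  subject-reduction* ⊢M ε        = ⊢M
  subject-reduction* ⊢M (st ◅ rs) = subject-reduction* (subject-reduction ⊢M st) rs

  subject-reduction-β : Prop3-SubjectReductionβ
  subject-reduction-β ⊢M st = ⊢′⇒⊢ (subject-reduction (⊢⇒⊢′ ⊢M) (Cl-map β-step st))

  -- Strong normalisation of β

  _⟶β*_ : Tm → Tm → Set
  _⟶β*_ = Star _⟶β_

  ⟶β-sub : SubstStable _⟶β_
  ⟶β-sub = Cl-sub ↦β-stable

  ⟶β-ren : ∀ ρ {M N} → M ⟶β N → ren ρ M ⟶β ren ρ N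
  ⟶β-ren = Cl-ren ↦β-stable

  mutual
    ren-⟶β-inv : ∀ ρ M {X} → ren ρ M ⟶β X → ∃ λ M′ → M ⟶β M′ × X ≡ ren ρ M′
    ren-⟶β-inv ρ (var x) (top ())
    ren-⟶β-inv ρ TYPE    (top ())
    ren-⟶β-inv ρ KIND    (top ())
    ren-⟶β-inv ρ (Π A B) (top ())
    ren-⟶β-inv ρ (Π A B) (Π₁ st) with ren-⟶β-inv ρ A st
    ... | A′ , st′ , refl = Π A′ B , Π₁ st′ , refl
    ren-⟶β-inv ρ (Π A B) (Π₂ st) with ren-⟶β-inv (ext ρ) B st
    ... | B′ , st′ , refl = Π A B′ , Π₂ st′ , refl
    ren-⟶β-inv ρ (ƛ A M) (top ())
    ren-⟶β-inv ρ (ƛ A M) (ƛ₁ st) with ren-⟶β-inv ρ A st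
    ... | A′ , st′ , refl = ƛ A′ M , ƛ₁ st′ , refl
    ren-⟶β-inv ρ (ƛ A M) (ƛ₂ st) with ren-⟶β-inv (ext ρ) M st
    ... | M′ , st′ , refl = ƛ A M′ , ƛ₂ st′ , refl
    ren-⟶β-inv ρ (M · N) (·₁ st) with ren-⟶β-inv ρ M st
    ... | M′ , st′ , refl = M′ · N , ·₁ st′ , refl
    ren-⟶β-inv ρ (M · N) (·₂ st) with ren-⟶β-inv ρ N st
    ... | N′ , st′ , refl = M · N′ , ·₂ st′ , refl
    ren-⟶β-inv ρ (ƛ A M · N)    (top (beta _ _ _)) = M [ N ]₀ , top (beta A M N) , sym (ren-[]₀ ρ N M)
    ren-⟶β-inv ρ (var x · N)    (top ())
    ren-⟶β-inv ρ (TYPE · N)     (top ())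
    ren-⟶β-inv ρ (KIND · N)     (top ())
    ren-⟶β-inv ρ (Π _ _ · N)    (top ())
    ren-⟶β-inv ρ ((_ · _) · N)  (top ())
    ren-⟶β-inv ρ (con _ _ · N)  (top ())
    ren-⟶β-inv ρ (con c Ms) (top ())
    ren-⟶β-inv ρ (con c Ms) (conₐ st) with renL-⟶β-inv ρ Ms st
    ... | Ms′ , st′ , refl = con c Ms′ , conₐ st′ , refl

    renL-⟶β-inv : ∀ ρ Ms {Xs} → ClL _↦β_ (renL ρ Ms) Xs →
                  ∃ λ Ms′ → ClL _↦β_ Ms Ms′ × Xs ≡ renL ρ Ms′
    renL-⟶β-inv ρ (M ∷ Ms) (hd st) with ren-⟶β-inv ρ M st
    ... | M′ , st′ , refl = M′ ∷ Ms , hd st′ , refl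
    renL-⟶β-inv ρ (M ∷ Ms) (tl st) with renL-⟶β-inv ρ Ms st
    ... | Ms′ , st′ , refl = M ∷ Ms′ , tl st′ , refl

  SNL : List Tm → Set
  SNL = Acc (flip (ClL _↦β_))

  SN-ren : ∀ ρ {M} → SNβ M → SNβ (ren ρ M)
  SN-ren ρ {M} (acc sn) = acc reducts-SN
    where
    reducts-SN : ∀ {X} → ren ρ M ⟶β X → SNβ X
    reducts-SN st with ren-⟶β-inv ρ M st
    ... | M′ , st′ , refl = SN-ren ρ (sn st′)

  SN-unren : ∀ ρ {M} → SNβ (ren ρ M) → SNβ M
  SN-unren ρ (acc sn) = acc λ st → SN-unren ρ (sn (⟶β-ren ρ st))

  SN-·ˡ : ∀ {M N} → SNβ (M · N) → SNβ M
  SN-·ˡ (acc sn) = acc λ st → SN-·ˡ (sn (·₁ st))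

  SN-TYPE : SNβ TYPE
  SN-TYPE = acc λ { (top ()) }

  SN-Π : ∀ {A B} → SNβ A → SNβ B → SNβ (Π A B)
  SN-Π (acc snA) (acc snB) = acc λ
    { (top ())
    ; (Π₁ st) → SN-Π (snA st) (acc snB)
    ; (Π₂ st) → SN-Π (acc snA) (snB st) }

  SNL-∷ : ∀ {M Ms} → SNβ M → SNL Ms → SNL (M ∷ Ms)
  SNL-∷ (acc sn) (acc snL) = acc λ
    { (hd st) → SNL-∷ (sn st) (acc snL)
    ; (tl st) → SNL-∷ (acc sn) (snL st) }

  SNL⇒SN-con : ∀ {c Ms} → SNL Ms → SNβ (con c Ms)
  SNL⇒SN-con (acc snL) = acc λ { (top ()) ; (conₐ st) → SNL⇒SN-con (snL st) }

  infixr 6 _⟹_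

  data Ty : Set where
    o   : Ty
    _⟹_ : Ty → Ty → Ty

  data _∋ₛ_∶_ : List Ty → ℕ → Ty → Set where
    here  : ∀ {τ Θ} → (τ ∷ Θ) ∋ₛ zero ∶ τ
    there : ∀ {τ τ′ Θ x} → Θ ∋ₛ x ∶ τ → (τ′ ∷ Θ) ∋ₛ suc x ∶ τ

  ∣_∣ : Tm → Ty
  ∣ var x ∣    = o
  ∣ TYPE ∣     = o
  ∣ KIND ∣     = o
  ∣ Π A B ∣    = ∣ A ∣ ⟹ ∣ B ∣
  ∣ ƛ A M ∣    = ∣ M ∣
  ∣ M · N ∣    = ∣ M ∣
  ∣ con c Ms ∣ = o

  mutual
    data _⊩_∶_ (Θ : List Ty) : Tm → Ty → Set where
      ⊩var  : ∀ {x τ} → Θ ∋ₛ x ∶ τ → Θ ⊩ var x ∶ τ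
      ⊩TYPE : Θ ⊩ TYPE ∶ o
      ⊩Π    : ∀ {A B τ₁ τ₂} → Θ ⊩ A ∶ τ₁ → (∣ A ∣ ∷ Θ) ⊩ B ∶ τ₂ → Θ ⊩ Π A B ∶ o
      ⊩ƛ    : ∀ {A M τ₁ τ} → Θ ⊩ A ∶ τ₁ → (∣ A ∣ ∷ Θ) ⊩ M ∶ τ → Θ ⊩ ƛ A M ∶ (∣ A ∣ ⟹ τ)
      ⊩·    : ∀ {M N τ τ′} → Θ ⊩ M ∶ (τ ⟹ τ′) → Θ ⊩ N ∶ τ → Θ ⊩ M · N ∶ τ′
      ⊩con  : ∀ {c Ms} → Θ ⊩L Ms → Θ ⊩ con c Ms ∶ o

    data _⊩L_ (Θ : List Ty) : List Tm → Set where
      []  : Θ ⊩L []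
      _∷_ : ∀ {M Ms τ} → Θ ⊩ M ∶ τ → Θ ⊩L Ms → Θ ⊩L (M ∷ Ms)

  Neutral : Tm → Set
  Neutral (ƛ _ _) = ⊥
  Neutral _       = ⊤

  neutral-·-no-redex : ∀ {ρ M N X} → Neutral M → ¬ (ren ρ M · N) ↦β X
  neutral-·-no-redex {M = ƛ _ _}   () _
  neutral-·-no-redex {M = var x}   n  ()
  neutral-·-no-redex {M = TYPE}    n  ()
  neutral-·-no-redex {M = KIND}    n  ()
  neutral-·-no-redex {M = Π _ _}   n  ()
  neutral-·-no-redex {M = _ · _}   n  ()
  neutral-·-no-redex {M = con _ _} n  ()

  -- Reducibility candidates, closed under renaming (Kripke-style) so that
  -- they survive going under binders.
  RED : Ty → Tm → Set
  RED o       M = SNβ M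
  RED (τ ⟹ τ′) M = ∀ ρ N → RED τ N → RED τ′ (ren ρ M · N)

  mutual
    RED⇒SN : ∀ τ {M} → RED τ M → SNβ M
    RED⇒SN o        r = r
    RED⇒SN (τ ⟹ τ′) r =
      SN-unren suc (SN-·ˡ (RED⇒SN τ′ (r suc (var 0) (RED-neutral τ tt λ { (top ()) }))))

    RED-⟶β : ∀ τ {M M′} → RED τ M → M ⟶β M′ → RED τ M′
    RED-⟶β o        (acc sn) st = sn st
    RED-⟶β (τ ⟹ τ′) r st ρ N rN = RED-⟶β τ′ (r ρ N rN) (·₁ (⟶β-ren ρ st))

    RED-neutral : ∀ τ {M} → Neutral M → (∀ {M′} → M ⟶β M′ → RED τ M′) → RED τ M
    RED-neutral o        n reds = acc reds
    RED-neutral (τ ⟹ τ′) {M} n reds ρ N rN = applied N (RED⇒SN τ rN) rN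
      where
      applied : ∀ N → SNβ N → RED τ N → RED τ′ (ren ρ M · N)
      applied N (acc snN) rN = RED-neutral τ′ tt reducts
        where
        reducts : ∀ {X} → (ren ρ M · N) ⟶β X → RED τ′ X
        reducts (·₁ st) with ren-⟶β-inv ρ M st
        ... | M′ , st′ , refl = reds st′ ρ N rN
        reducts (·₂ st) = applied _ (snN st) (RED-⟶β τ rN st)
        reducts (top b) = ⊥-elim (neutral-·-no-redex n b)

  RED-⟶β* : ∀ τ {M M′} → RED τ M → M ⟶β* M′ → RED τ M′
  RED-⟶β* τ r ε         = r
  RED-⟶β* τ r (st ◅ rs) = RED-⟶β* τ (RED-⟶β τ r st) rs

  RED-ren : ∀ τ ρ {M} → RED τ M → RED τ (ren ρ M)
  RED-ren o        ρ r = SN-ren ρ r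
  RED-ren (τ ⟹ τ′) ρ {M} r ρ′ N rN =
    subst (λ X → RED τ′ (X · N)) (sym (ren-ren ρ′ ρ M)) (r (ρ′ ∘ ρ) N rN)

  RED-var : ∀ τ {x} → RED τ (var x)
  RED-var τ = RED-neutral τ tt λ { (top ()) }

  RED-β-expand : ∀ τ {A M N} → SNβ A → SNβ M → SNβ N → RED τ (M [ N ]₀) → RED τ (ƛ A M · N)
  RED-β-expand τ {A} {M} {N} (acc snA) (acc snM) (acc snN) r = RED-neutral τ tt reducts
    where
    reducts : ∀ {X} → (ƛ A M · N) ⟶β X → RED τ X
    reducts (top (beta _ _ _)) = r
    reducts (·₁ (top ()))
    reducts (·₁ (ƛ₁ st)) = RED-β-expand τ (snA st) (acc snM) (acc snN) r
    reducts (·₁ (ƛ₂ st)) = RED-β-expand τ (acc snA) (snM st) (acc snN) (RED-⟶β τ r (⟶β-sub _ st))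
    reducts (·₂ st)      = RED-β-expand τ (acc snA) (acc snM) (snN st)
                             (RED-⟶β* τ r ([]₀-↠ ↦β-stable M st))

  REDˢ : List Ty → Sub → Set
  REDˢ Θ σ = ∀ {x τ} → Θ ∋ₛ x ∶ τ → RED τ (σ x)

  REDˢ-exts : ∀ {Θ σ τ} → REDˢ Θ σ → REDˢ (τ ∷ Θ) (exts σ)
  REDˢ-exts {τ = τ} rs here = RED-var τ
  REDˢ-exts rs (there {τ = τ′} x) = RED-ren τ′ suc (rs x)

  REDˢ-• : ∀ {Θ σ τ N} → RED τ N → REDˢ Θ σ → REDˢ (τ ∷ Θ) (N • σ)
  REDˢ-• r rs here      = r
  REDˢ-• r rs (there x) = rs x

  mutual
    fundamental : ∀ {Θ σ M τ} → Θ ⊩ M ∶ τ → REDˢ Θ σ → RED τ (sub σ M)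
    fundamental (⊩var x)   rs = rs x
    fundamental ⊩TYPE      rs = SN-TYPE
    fundamental (⊩Π ⊩A ⊩B) rs =
      SN-Π (RED⇒SN _ (fundamental ⊩A rs)) (RED⇒SN _ (fundamental ⊩B (REDˢ-exts rs)))
    fundamental {σ = σ} (⊩ƛ {A} {M} {τ₁} {τ} ⊩A ⊩M) rs ρ N rN
      rewrite ren-sub ρ σ A | ren-sub-exts ρ σ M =
      RED-β-expand τ (RED⇒SN τ₁ (fundamental ⊩A rs′)) (RED⇒SN τ (fundamental ⊩M (REDˢ-exts rs′)))
        (RED⇒SN _ rN)
        (subst (RED τ) (sym (sub-exts-[]₀ (ren ρ ∘ σ) N M)) (fundamental ⊩M (REDˢ-• rN rs′)))
      where
      rs′ : REDˢ _ (ren ρ ∘ σ)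
      rs′ {τ = τ′} x = RED-ren τ′ ρ (rs x)
    fundamental {σ = σ} (⊩· {M = M} {N} {τ′ = τ′} ⊩M ⊩N) rs =
      subst (λ X → RED τ′ (X · sub σ N)) (ren-id (sub σ M))
            (fundamental ⊩M rs id (sub σ N) (fundamental ⊩N rs))
    fundamental (⊩con ⊩Ms) rs = SNL⇒SN-con (fundamentalL ⊩Ms rs)

    fundamentalL : ∀ {Θ σ Ms} → Θ ⊩L Ms → REDˢ Θ σ → SNL (subL σ Ms)
    fundamentalL []           rs = acc λ ()
    fundamentalL (⊩M ∷ ⊩Ms) rs = SNL-∷ (RED⇒SN _ (fundamental ⊩M rs)) (fundamentalL ⊩Ms rs)

  simply-typed⇒SN : ∀ {Θ M τ} → Θ ⊩ M ∶ τ → SNβ M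
  simply-typed⇒SN {M = M} {τ} ⊩M =
    RED⇒SN τ (subst (RED τ) (sub-var (λ _ → refl) M) (fundamental ⊩M (λ {_} {τ′} _ → RED-var τ′)))

  -- Erasure of Dedukti typing to simple types

  ∣∣-ren : ∀ ρ M → ∣ ren ρ M ∣ ≡ ∣ M ∣
  ∣∣-ren ρ (var x)    = refl
  ∣∣-ren ρ TYPE       = refl
  ∣∣-ren ρ KIND       = refl
  ∣∣-ren ρ (Π A B)    = cong₂ _⟹_ (∣∣-ren ρ A) (∣∣-ren (ext ρ) B)
  ∣∣-ren ρ (ƛ A M)    = ∣∣-ren (ext ρ) M
  ∣∣-ren ρ (M · N)    = ∣∣-ren ρ M
  ∣∣-ren ρ (con c Ms) = refl

  ErasesToBase : Sub → Set
  ErasesToBase σ = ∀ x → ∣ σ x ∣ ≡ o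

  ErasesToBase-exts : ∀ {σ} → ErasesToBase σ → ErasesToBase (exts σ)
  ErasesToBase-exts e zero        = refl
  ErasesToBase-exts {σ} e (suc x) = trans (∣∣-ren suc (σ x)) (e x)

  ∣∣-sub : ∀ {σ} → ErasesToBase σ → ∀ M → ∣ sub σ M ∣ ≡ ∣ M ∣
  ∣∣-sub e (var x)    = e x
  ∣∣-sub e TYPE       = refl
  ∣∣-sub e KIND       = refl
  ∣∣-sub e (Π A B)    = cong₂ _⟹_ (∣∣-sub e A) (∣∣-sub (ErasesToBase-exts e) B)
  ∣∣-sub e (ƛ A M)    = ∣∣-sub (ErasesToBase-exts e) M
  ∣∣-sub e (M · N)    = ∣∣-sub e M
  ∣∣-sub e (con c Ms) = refl

  ∣∣-[]₀ : ∀ {N} → ∣ N ∣ ≡ o → ∀ M → ∣ M [ N ]₀ ∣ ≡ ∣ M ∣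
  ∣∣-[]₀ {N} e = ∣∣-sub single-erases
    where
    single-erases : ErasesToBase (single N)
    single-erases zero    = e
    single-erases (suc x) = refl

  data Arity : Tm → Set where
    TYPE : Arity TYPE
    KIND : Arity KIND
    Π    : ∀ {A K} → Arity K → Arity (Π A K)

  Arity-sub : ∀ σ {K} → Arity K → Arity (sub σ K)
  Arity-sub σ TYPE  = TYPE
  Arity-sub σ KIND  = KIND
  Arity-sub σ (Π k) = Π (Arity-sub (exts σ) k)

  Arity-⟶βR : ∀ {K P} → Arity K → K ⟶βR P → Arity P
  Arity-⟶βR TYPE  (top (β-step ()))
  Arity-⟶βR TYPE  (top (R-step ()))
  Arity-⟶βR KIND  (top (β-step ()))
  Arity-⟶βR KIND  (top (R-step ()))
  Arity-⟶βR (Π k) (top (β-step ()))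
  Arity-⟶βR (Π k) (top (R-step ()))
  Arity-⟶βR (Π k) (Π₁ st) = Π k
  Arity-⟶βR (Π k) (Π₂ st) = Π (Arity-⟶βR k st)

  Arity-⟶βR* : ∀ {K P} → Arity K → K ⟶βR* P → Arity P
  Arity-⟶βR* k ε         = k
  Arity-⟶βR* k (st ◅ rs) = Arity-⟶βR* (Arity-⟶βR k st) rs

  IsSort⇒Arity : ∀ {s} → IsSort s → Arity s
  IsSort⇒Arity sTYPE = TYPE
  IsSort⇒Arity sKIND = KIND

  ConvertibleToArity : Tm → Set
  ConvertibleToArity T = ∃ λ K → Arity K × T ≡βR K

  ∣object∣≡o : ∀ {Γ M T} → Γ ⊢′ M ∶ T → ¬ ConvertibleToArity T → ∣ M ∣ ≡ o
  ∣object∣≡o (⊢sort w)              ¬ar = refl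
  ∣object∣≡o (⊢var w x)             ¬ar = refl
  ∣object∣≡o (⊢U s w)               ¬ar = refl
  ∣object∣≡o (⊢El s w ⊢A)           ¬ar = refl
  ∣object∣≡o (⊢u w a)               ¬ar = refl
  ∣object∣≡o (⊢Prod w r ⊢A ⊢B)      ¬ar = refl
  ∣object∣≡o (⊢abs w r ⊢A ⊢B ⊢M)    ¬ar = refl
  ∣object∣≡o (⊢app w r ⊢A ⊢B ⊢M ⊢N) ¬ar = refl
  ∣object∣≡o (⊢conv d s e c) ¬ar = ∣object∣≡o d λ { (K , k , e′) → ¬ar (K , k , ≡βR-sym c ◅◅ e′) }
  ∣object∣≡o (⊢Π s ⊢A ⊢B)    ¬ar = ⊥-elim (¬ar (_ , IsSort⇒Arity s , ε))
  ∣object∣≡o (⊢ƛ s ⊢A ⊢B ⊢M) ¬ar = ∣object∣≡o ⊢M λ { (K , k , e) → ¬ar (Π _ K , Π k , Π-≡ ε e) }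
  ∣object∣≡o (⊢· {N = N} ⊢M ⊢N) ¬ar = ∣object∣≡o ⊢M ¬Π-arity
    where
    ¬Π-arity : ¬ ConvertibleToArity _
    ¬Π-arity (_ , TYPE , e)              = TYPE≢Π (≡βR-sym e)
    ¬Π-arity (_ , KIND , e)              = KIND≢Π (≡βR-sym e)
    ¬Π-arity (_ , Π {K = K} k , e) =
      ¬ar (K [ N ]₀ , Arity-sub _ k , ≡βR-sub (single N) (proj₂ (Π-injective e)))

  arity-typed-by-KIND : ∀ {Γ K T} → Γ ⊢′ K ∶ T → Arity K → T ≡βR KIND
  arity-typed-by-KIND (⊢sort w)       TYPE  = ε
  arity-typed-by-KIND (⊢conv d s e c) k     = ≡βR-sym c ◅◅ arity-typed-by-KIND d k
  arity-typed-by-KIND (⊢Π s ⊢A ⊢B)    (Π k) = arity-typed-by-KIND ⊢B k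

  type-not-arity : ∀ {Γ A} → Γ ⊢′ A ∶ TYPE → ¬ ConvertibleToArity A
  type-not-arity ⊢A (K , k , e) with church-rosser e
  ... | _ , ps , qs = TYPE≢KIND (arity-typed-by-KIND (subject-reduction* ⊢A ps) (Arity-⟶βR* k qs))

  ∣argument∣≡o : ∀ {Γ M A B N} → Γ ⊢′ M ∶ Π A B → Γ ⊢′ N ∶ A → ∣ N ∣ ≡ o
  ∣argument∣≡o ⊢M ⊢N with validity ⊢M
  ... | inj₂ (_ , _ , ⊢ΠAB) = ∣object∣≡o ⊢N (type-not-arity (proj₁ (Π-inversion ⊢ΠAB)))

  ∣∣-⟶βR : ∀ {Γ X X′ T} → Γ ⊢′ X ∶ T → X ⟶βR X′ → ∣ X ∣ ≡ ∣ X′ ∣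
  ∣∣-⟶βR ⊢X (conₐ st)             = refl
  ∣∣-⟶βR ⊢X (top (R-step (r-El a))) = refl
  ∣∣-⟶βR ⊢X (top (R-step (r-app r _ _ _ _ _ _))) with app-inversion ⊢X
  ... | _ , ⊢abs′ with abs-inversion ⊢abs′
  ...   | _ , _ , ⊢A , ⊢B , ⊢M , _ = sym (∣object∣≡o ⊢M (type-not-arity (⊢′-ΠElEl ⊢A ⊢B)))
  ∣∣-⟶βR ⊢X (top (β-step (beta _ M _))) with ·-inversion ⊢X
  ... | _ , _ , ⊢ƛ′ , ⊢N = sym (∣∣-[]₀ (∣argument∣≡o ⊢ƛ′ ⊢N) M)
  ∣∣-⟶βR ⊢X (Π₁ st) = cong₂ _⟹_ (∣∣-⟶βR (proj₁ (Π-inversion ⊢X)) st) refl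
  ∣∣-⟶βR ⊢X (Π₂ st) with Π-inversion ⊢X
  ... | _ , _ , _ , ⊢B = cong₂ _⟹_ refl (∣∣-⟶βR ⊢B st)
  ∣∣-⟶βR ⊢X (ƛ₁ st) = refl
  ∣∣-⟶βR ⊢X (ƛ₂ st) with ƛ-inversion ⊢X
  ... | _ , _ , _ , _ , _ , ⊢M , _ = ∣∣-⟶βR ⊢M st
  ∣∣-⟶βR ⊢X (·₁ st) with ·-inversion ⊢X
  ... | _ , _ , ⊢M , _ = ∣∣-⟶βR ⊢M st
  ∣∣-⟶βR ⊢X (·₂ st) = refl

  ∣∣-⟶βR* : ∀ {Γ X X′ T} → Γ ⊢′ X ∶ T → X ⟶βR* X′ → ∣ X ∣ ≡ ∣ X′ ∣
  ∣∣-⟶βR* ⊢X ε         = refl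
  ∣∣-⟶βR* ⊢X (st ◅ rs) = trans (∣∣-⟶βR ⊢X st) (∣∣-⟶βR* (subject-reduction ⊢X st) rs)

  ∣∣-conv : ∀ {Γ M A B s} → Γ ⊢′ M ∶ A → A ≡βR B → Γ ⊢′ B ∶ s → ∣ A ∣ ≡ ∣ B ∣
  ∣∣-conv ⊢M c ⊢B with church-rosser c | validity ⊢M
  ... | _ , ps , qs | inj₁ refl with KIND-⟶βR* ps
  ...   | refl = sym (∣∣-⟶βR* ⊢B qs)
  ∣∣-conv ⊢M c ⊢B | _ , ps , qs | inj₂ (_ , _ , ⊢A) = trans (∣∣-⟶βR* ⊢A ps) (sym (∣∣-⟶βR* ⊢B qs))

  ∋-erase : ∀ {Γ x A} → Γ ∋ x ∶ A → List.map ∣_∣ Γ ∋ₛ x ∶ ∣ A ∣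
  ∋-erase (here {Γ} {A}) =
    subst ((∣ A ∣ ∷ List.map ∣_∣ Γ) ∋ₛ zero ∶_) (sym (∣∣-ren suc A)) here
  ∋-erase (there {Γ} {A} {B} {i} x) =
    subst ((∣ B ∣ ∷ List.map ∣_∣ Γ) ∋ₛ suc i ∶_) (sym (∣∣-ren suc A)) (there (∋-erase x))

  erase : ∀ {Γ M T} → Γ ⊢′ M ∶ T → List.map ∣_∣ Γ ⊩ M ∶ ∣ T ∣
  erase (⊢sort w)              = ⊩TYPE
  erase (⊢var w x)             = ⊩var (∋-erase x)
  erase (⊢U s w)               = ⊩con []
  erase (⊢El s w ⊢A)           = ⊩con (erase ⊢A ∷ [])
  erase (⊢u w a)               = ⊩con []
  erase (⊢Prod w r ⊢A ⊢B)      = ⊩con (erase ⊢A ∷ erase ⊢B ∷ [])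
  erase (⊢abs w r ⊢A ⊢B ⊢M)    = ⊩con (erase ⊢A ∷ erase ⊢B ∷ erase ⊢M ∷ [])
  erase (⊢app w r ⊢A ⊢B ⊢M ⊢N) = ⊩con (erase ⊢A ∷ erase ⊢B ∷ erase ⊢M ∷ erase ⊢N ∷ [])
  erase (⊢conv d s e c)        = subst (_ ⊩ _ ∶_) (∣∣-conv d c e) (erase d)
  erase (⊢Π sTYPE ⊢A ⊢B)       = ⊩Π (erase ⊢A) (erase ⊢B)
  erase (⊢Π sKIND ⊢A ⊢B)       = ⊩Π (erase ⊢A) (erase ⊢B)
  erase (⊢ƛ s ⊢A ⊢B ⊢M)        = ⊩ƛ (erase ⊢A) (erase ⊢M)
  erase (⊢· {B = B} ⊢M ⊢N)     =
    subst (_ ⊩ _ ∶_) (sym (∣∣-[]₀ (∣argument∣≡o ⊢M ⊢N) B)) (⊩· (erase ⊢M) (erase ⊢N))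

  strong-normalisation : Prop4-StrongNormalisationβ
  strong-normalisation ⊢M = simply-typed⇒SN (erase (⊢⇒⊢′ ⊢M))

mainTheorem9 : (𝒮 : Spec) → let open Encoding 𝒮 in
    Prop1-Confluence × Prop2-SignatureWellTyped × Prop3-SubjectReductionβ
    × Prop4-StrongNormalisationβ × Prop5-SubstitutionCommutes
mainTheorem9 𝒮 =
  confluence , signature-well-typed , subject-reduction-β , strong-normalisation , ⟦⟧-[]₀
  where open Theory 𝒮
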